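{- Let $M_n(q,t)=\sum_{\iota\in\mathcal{I}_n(132)}q^{\mathrm{comaj}(\iota)}t^{\mathrm{asc}(\iota)}$ and $F_{n}(q,t)=\sum_{\iota\in F\mathcal{I}_n(132)}q^{\mathrm{comaj}(\iota)}t^{\mathrm{asc}(\iota)}$. Then $M_0(q,t)=M_1(q,t)=1$ and for $n\geq 2$, $$M_n(q,t)=q^{n-1}t\,M_{n-1}(q,t)+M_{n-2}(q,qt)+\sum_{k=2}^{\lfloor n/2\rfloor} q^{n+k-2}t^2\,F_{2(k-1)}\!\left(q,q^{\frac{n-2k+1}{2}}t\right)M_{n-2k}(q,q^kt).$$
   Context: A permutation $\sigma$ of $[n]$ (one-line notation) contains a pattern $\pi\in\mathfrak{S}_k$ if some subsequence $\sigma(m_1)\cdots\sigma(m_k)$ with $m_1<\dots<m_k$ is in the same relative order as $\pi$; otherwise it avoids $\pi$. $\mathcal{I}_n(\pi)$ (resp. $F\mathcal{I}_n(\pi)$) is the set of involutions (resp. fixed-point-free involutions, i.e. with $\iota(i)\ne i$ for all $i$) of $[n]$ avoiding $\pi$; for $n=0$ these consist of the empty permutation. $\mathrm{Asc}(\sigma)=\{i\in[n-1]:\sigma(i)<\sigma(i+1)\}$, $\mathrm{asc}(\sigma)=|\mathrm{Asc}(\sigma)|$, $\mathrm{comaj}(\sigma)=\sum_{i\in\mathrm{Asc}(\sigma)}i$. Substituting $q^{c}t$ for $t$ with half-integer $c$ is understood formally. -}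

module Defs where

open import Data.Nat using (ℕ; zero; suc; _+_; _*_; _∸_; _<ᵇ_; _≡ᵇ_; ⌊_/2⌋)
open import Data.Bool using (Bool; true; false; _∧_; not; if_then_else_)
open import Data.Product using (_×_; _,_)
open import Data.List using (List; []; _∷_; _++_; map; concatMap; filter; length; upTo)
open import Data.Nat.ListAction using (sum)
open import Data.Bool.ListAction using (any; all)
open import Data.List.Relation.Binary.Permutation.Propositional using (_↭_)
open import Relation.Nullary.Decidable using (Dec; yes; no)
open import Data.Bool using (T)
open import Data.Bool.Properties using (T?)

-- Permutations in one-line notation: a permutation of [n] is the list
-- σ(1) σ(2) ... σ(n).

insertEverywhere : ℕ → List ℕ → List (List ℕ)
insertEverywhere x []       = (x ∷ []) ∷ []
insertEverywhere x (y ∷ ys) = (x ∷ y ∷ ys) ∷ map (y ∷_) (insertEverywhere x ys)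

perms : ℕ → List (List ℕ)
perms zero    = [] ∷ []
perms (suc n) = concatMap (insertEverywhere (suc n)) (perms n)

at0 : List ℕ → ℕ → ℕ
at0 []       _       = 0
at0 (x ∷ xs) zero    = x
at0 (x ∷ xs) (suc i) = at0 xs i

-- σ(i) for 1-based i
app : List ℕ → ℕ → ℕ
app σ i = at0 σ (i ∸ 1)

positions : ℕ → List ℕ
positions n = map suc (upTo n)

isInvolution : List ℕ → Bool
isInvolution σ = all (λ i → app σ (app σ i) ≡ᵇ i) (positions (length σ))

isFixedPointFree : List ℕ → Bool
isFixedPointFree σ = all (λ i → not (app σ i ≡ᵇ i)) (positions (length σ))

subseqs : List ℕ → List (List ℕ)
subseqs []       = [] ∷ []
subseqs (x ∷ xs) = map (x ∷_) (subseqs xs) ++ subseqs xs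

sameOrder : List ℕ → List ℕ → Bool
sameOrder s p =
  (length s ≡ᵇ length p) ∧
  all (λ a → all (λ b → eqB (at0 s a <ᵇ at0 s b) (at0 p a <ᵇ at0 p b))
                 (upTo (length p)))
      (upTo (length p))
  where
  eqB : Bool → Bool → Bool
  eqB true  true  = true
  eqB false false = true
  eqB _     _     = false

contains : List ℕ → List ℕ → Bool
contains σ π = any (λ s → sameOrder s π) (subseqs σ)

avoids : List ℕ → List ℕ → Bool
avoids σ π = not (contains σ π)

pat132 : List ℕ
pat132 = 1 ∷ 3 ∷ 2 ∷ []

I132 : ℕ → List (List ℕ)
I132 n = filter (λ σ → T? (isInvolution σ ∧ avoids σ pat132)) (perms n)

FI132 : ℕ → List (List ℕ)
FI132 n = filter (λ σ → T? (isInvolution σ ∧ isFixedPointFree σ ∧ avoids σ pat132)) (perms n)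

Asc : List ℕ → List ℕ
Asc σ = filter (λ i → T? (app σ i <ᵇ app σ (suc i))) (positions (length σ ∸ 1))

asc : List ℕ → ℕ
asc σ = length (Asc σ)

comaj : List ℕ → ℕ
comaj σ = sum (Asc σ)

-- Formal polynomials in q^{1/2}, t with nonnegative integer coefficients,
-- represented as multisets (lists) of monomials; a monomial q^{a/2} t^b
-- is the pair (a , b)  (q-exponent stored DOUBLED so that substitutions
-- t ↦ q^c t with half-integer c are exact). Polynomial equality is
-- multiset equality _↭_ (= equality of all coefficients).

Mon : Set
Mon = ℕ × ℕ

Poly : Set
Poly = List Mon

one : Poly
one = (0 , 0) ∷ []

mulMon : Mon → Poly → Poly
mulMon (a , b) = map (λ { (x , y) → (x + a , y + b) })

_⊗_ : Poly → Poly → Poly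
p ⊗ r = concatMap (λ u → mulMon u r) p

substT : ℕ → Poly → Poly
substT m = map (λ { (x , y) → (x + m * y , y) })

genFun : List (List ℕ) → Poly
genFun = map (λ σ → (2 * comaj σ , asc σ))

M : ℕ → Poly
M n = genFun (I132 n)

F : ℕ → Poly
F n = genFun (FI132 n)

kRange : ℕ → List ℕ
kRange n = map (λ j → j + 2) (upTo (⌊ n /2⌋ ∸ 1))

recRHS : ℕ → Poly
recRHS n =
  mulMon (2 * (n ∸ 1) , 1) (M (n ∸ 1))
  ++ substT 2 (M (n ∸ 2))
  ++ concatMap
       (λ k → mulMon (2 * (n + k ∸ 2) , 2)
                (substT (n ∸ 2 * k + 1) (F (2 * (k ∸ 1)))
                 ⊗ substT (2 * k) (M (n ∸ 2 * k))))
       (kRange n)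

module Submission where

-- The proof is bijective.  A 132-avoiding involution σ of [n] either ends in its
-- maximum (σ = τ , n with τ ∈ I_{n-1}(132)), or it is an assembly
--   (H1 + r + 1) , n , (τ + j + 1) , H2 , j + 1        with n = 2j + r + 2,
-- of some τ ∈ I_r(132) and a fixed-point-free φ = H1 ++ H2 ∈ FI_{2j}(132); j = 0 gives
-- the term M_{n-2}(q,qt) and j = k - 1 ≥ 1 the k-th summand.  The first half H1 of such
-- a φ lies above j, the second half at most j, and both halves have equally many
-- ascents ("half-split"), which makes the statistics of an assembly computable.

open import Defs
open import Data.Nat as ℕ
  using (ℕ; zero; suc; _+_; _*_; _∸_; _<_; _≤_; _<ᵇ_; _≡ᵇ_; z≤n; s≤s; _≟_; _≤?_; ⌊_/2⌋)
open import Data.Nat.Properties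
open import Data.Nat.ListAction using (sum)
open import Data.Nat.Tactic.RingSolver using (solve-∀)
open import Data.Bool using (Bool; true; false; _∧_; not; T; if_then_else_)
open import Data.Bool.Properties using (T?; T-∧; T-≡; T-not-≡)
open import Data.Bool.ListAction using (all; any)
open import Data.List
  using (List; []; _∷_; _++_; map; concatMap; filter; length; upTo; applyUpTo; take; drop; last; initLast; _∷ʳ′_)
open import Data.List.Properties
  using ( length-++; length-map; ++-assoc; map-++; take-map; drop-map
        ; length-take; length-drop; take++drop≡id; map-applyUpTo; length-upTo
        ; ++-cancelˡ; ++-cancelʳ; ∷-injective; ∷-injectiveʳ; map-injective )
open import Data.List.Membership.Propositional using (_∈_; _∉_; find)
open import Data.List.Membership.Propositional.Properties
open import Data.List.Membership.Propositional.Properties.WithK using (unique∧set⇒bag)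
open import Data.List.Relation.Unary.Any using (Any; here; there)
import Data.List.Relation.Unary.Any as Any
open import Data.List.Relation.Unary.All using (All; []; _∷_)
import Data.List.Relation.Unary.All as All
import Data.List.Relation.Unary.All.Properties as AllP
import Data.List.Relation.Unary.Any.Properties as AnyP
open import Data.List.Relation.Unary.AllPairs using ([]; _∷_)
open import Data.List.Relation.Unary.Unique.Propositional using (Unique)
import Data.List.Relation.Unary.Unique.Propositional.Properties as Unique
open import Data.List.Relation.Binary.Sublist.Propositional using (_⊆_; []; _∷_; _∷ʳ_; from∈; lookup)
import Data.List.Relation.Binary.Sublist.Propositional.Properties as Sublist
open import Data.List.Relation.Binary.Permutation.Propositional using (_↭_; ↭-refl; ↭-trans; ↭-reflexive)
import Data.List.Relation.Binary.Permutation.Propositional.Properties as Perm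
open import Data.List.Relation.Binary.BagAndSetEquality using (∼bag⇒↭)
open import Data.Product using (Σ; ∃; ∃₂; _×_; _,_; proj₁; proj₂)
open import Data.Maybe using (just)
open import Data.Maybe.Properties using (just-injective)
open import Data.Sum using (_⊎_; inj₁; inj₂; [_,_]′)
open import Data.Empty using (⊥; ⊥-elim)
open import Data.Unit using (tt)
open import Function using (_∘_; Equivalence; mk⇔)
open import Relation.Nullary using (¬_; yes; no)
open import Relation.Binary.PropositionalEquality
open import Relation.Binary.Definitions using (tri<; tri≈; tri>)
open import Data.Nat.Induction using (<-rec)

T-not⁻ : ∀ {b} → T (not b) → ¬ T b
T-not⁻ {true} () _

T-not⁺ : ∀ {b} → ¬ T b → T (not b)
T-not⁺ {true}  h = h tt
T-not⁺ {false} h = tt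

<ᵇ-irrefl : ∀ a → (a <ᵇ a) ≡ false
<ᵇ-irrefl zero    = refl
<ᵇ-irrefl (suc a) = <ᵇ-irrefl a

<⇒<ᵇ≡true : ∀ {a b} → a < b → (a <ᵇ b) ≡ true
<⇒<ᵇ≡true {a} {b} a<b = Equivalence.to T-≡ (<⇒<ᵇ a<b)

≥⇒<ᵇ≡false : ∀ {a b} → b ≤ a → (a <ᵇ b) ≡ false
≥⇒<ᵇ≡false {a} {b} b≤a = Equivalence.to T-not-≡ (T-not⁺ (λ t → ≤⇒≯ b≤a (<ᵇ⇒< a b t)))

data At : List ℕ → ℕ → ℕ → Set where
  at-head : ∀ {x xs} → At (x ∷ xs) 0 x
  at-tail : ∀ {x xs i v} → At xs i v → At (x ∷ xs) (suc i) v

At⇒at0 : ∀ {xs i v} → At xs i v → at0 xs i ≡ v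
At⇒at0 at-head     = refl
At⇒at0 (at-tail h) = At⇒at0 h

at0⇒At : ∀ xs i → i < length xs → At xs i (at0 xs i)
at0⇒At (x ∷ xs) zero    _       = at-head
at0⇒At (x ∷ xs) (suc i) (s≤s h) = at-tail (at0⇒At xs i h)

At-bound : ∀ {xs i v} → At xs i v → i < length xs
At-bound at-head     = s≤s z≤n
At-bound (at-tail h) = s≤s (At-bound h)

At-functional : ∀ {xs i v w} → At xs i v → At xs i w → v ≡ w
At-functional at-head     at-head     = refl
At-functional (at-tail h) (at-tail g) = At-functional h g

At⇒∈ : ∀ {xs i v} → At xs i v → v ∈ xs
At⇒∈ at-head     = here refl
At⇒∈ (at-tail h) = there (At⇒∈ h)

∈⇒At : ∀ {xs v} → v ∈ xs → ∃ λ i → At xs i v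
∈⇒At (here refl) = 0 , at-head
∈⇒At (there m)   = let i , h = ∈⇒At m in suc i , at-tail h

At-exists : ∀ xs i → i < length xs → ∃ λ v → At xs i v
At-exists xs i h = at0 xs i , at0⇒At xs i h

At-++ˡ : ∀ {xs ys i v} → At xs i v → At (xs ++ ys) i v
At-++ˡ at-head     = at-head
At-++ˡ (at-tail h) = at-tail (At-++ˡ h)

At-++ʳ : ∀ xs {ys i v} → At ys i v → At (xs ++ ys) (length xs + i) v
At-++ʳ []       h = h
At-++ʳ (x ∷ xs) h = at-tail (At-++ʳ xs h)

At-++⁻ : ∀ xs {ys i v} → At (xs ++ ys) i v →
         At xs i v ⊎ (∃ λ i′ → i ≡ length xs + i′ × At ys i′ v)
At-++⁻ []       h           = inj₂ (_ , refl , h)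
At-++⁻ (x ∷ xs) at-head     = inj₁ at-head
At-++⁻ (x ∷ xs) (at-tail h) with At-++⁻ xs h
... | inj₁ h′              = inj₁ (at-tail h′)
... | inj₂ (i′ , refl , h′) = inj₂ (i′ , refl , h′)

At-map : ∀ (f : ℕ → ℕ) {xs i v} → At xs i v → At (map f xs) i (f v)
At-map f at-head     = at-head
At-map f (at-tail h) = at-tail (At-map f h)

At-map⁻ : ∀ (f : ℕ → ℕ) {xs i v} → At (map f xs) i v → ∃ λ w → At xs i w × v ≡ f w
At-map⁻ f {x ∷ xs} at-head     = x , at-head , refl
At-map⁻ f {x ∷ xs} (at-tail h) = let w , h′ , e = At-map⁻ f h in w , at-tail h′ , e

At-split : ∀ {xs i v} → At xs i v → ∃₂ λ P S → xs ≡ P ++ v ∷ S × length P ≡ i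
At-split {x ∷ xs} at-head     = [] , xs , refl , refl
At-split {x ∷ xs} (at-tail h) with At-split h
... | P , S , refl , refl = x ∷ P , S , refl , refl

At-last : ∀ n xs y → length (xs ++ y ∷ []) ≡ suc n → At (xs ++ y ∷ []) n y
At-last n xs y len = subst (λ k → At (xs ++ y ∷ []) k y) position (At-++ʳ xs at-head)
  where
  position : length xs + 0 ≡ n
  position = suc-injective (trans (cong suc (+-identityʳ _))
               (trans (sym (+-comm (length xs) 1)) (trans (sym (length-++ xs)) len)))

-- One-line involutions of [n], stated positionally (positions 0-based, values 1-based).

InRange : ℕ → List ℕ → Set
InRange n σ = ∀ {i v} → At σ i v → 1 ≤ v × v ≤ n

Involutive : List ℕ → Set
Involutive σ = ∀ {i v} → At σ i (suc v) → At σ v (suc i)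

FixedPointFree : List ℕ → Set
FixedPointFree σ = ∀ {i} → ¬ At σ i (suc i)

record Involution (n : ℕ) (σ : List ℕ) : Set where
  constructor involution
  field
    size       : length σ ≡ n
    inRange    : InRange n σ
    involutive : Involutive σ
open Involution public

∈-positions⁻ : ∀ {n x} → x ∈ positions n → ∃ λ i → x ≡ suc i × i < n
∈-positions⁻ m with ∈-map⁻ suc m
... | i , m′ , e = i , e , ∈-upTo⁻ m′

∈-positions⁺ : ∀ {n i} → i < n → suc i ∈ positions n
∈-positions⁺ h = ∈-map⁺ suc (∈-upTo⁺ h)

isInvolution⇒ : ∀ σ → InRange (length σ) σ → T (isInvolution σ) → Involutive σ
isInvolution⇒ σ r t {i} {v} h = subst (At σ v) σ[v]≡i (at0⇒At σ v (proj₂ (r h)))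
  where
  test : T (app σ (app σ (suc i)) ≡ᵇ suc i)
  test = All.lookup (AllP.all⁺ _ (positions (length σ)) t) (∈-positions⁺ (At-bound h))
  σ[v]≡i : at0 σ v ≡ suc i
  σ[v]≡i = subst (λ w → at0 σ (w ∸ 1) ≡ suc i) (At⇒at0 h) (≡ᵇ⇒≡ _ _ test)

isInvolution⇐ : ∀ σ → InRange (length σ) σ → Involutive σ → T (isInvolution σ)
isInvolution⇐ σ r iv = AllP.all⁻ _ (All.tabulate test)
  where
  test : ∀ {x} → x ∈ positions (length σ) → T (app σ (app σ x) ≡ᵇ x)
  test m with ∈-positions⁻ m
  ... | i , refl , i<n with at0 σ i | at0⇒At σ i i<n | r (at0⇒At σ i i<n)
  ... | suc v | h | _ = ≡⇒≡ᵇ _ _ (At⇒at0 (iv h))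

isFixedPointFree⇒ : ∀ σ → T (isFixedPointFree σ) → FixedPointFree σ
isFixedPointFree⇒ σ t {i} h = T-not⁻ test (≡⇒≡ᵇ _ _ (At⇒at0 h))
  where
  test : T (not (app σ (suc i) ≡ᵇ suc i))
  test = All.lookup (AllP.all⁺ _ (positions (length σ)) t) (∈-positions⁺ (At-bound h))

isFixedPointFree⇐ : ∀ σ → FixedPointFree σ → T (isFixedPointFree σ)
isFixedPointFree⇐ σ fp = AllP.all⁻ _ (All.tabulate test)
  where
  test : ∀ {x} → x ∈ positions (length σ) → T (not (app σ x ≡ᵇ x))
  test m with ∈-positions⁻ m
  ... | i , refl , i<n = T-not⁺ (λ t → fp (subst (At σ i) (≡ᵇ⇒≡ _ _ t) (at0⇒At σ i i<n)))

Involution-onto : ∀ {n σ} → Involution n σ → ∀ {j} → 1 ≤ j → j ≤ n → j ∈ σ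
Involution-onto {n} {σ} g {suc j} _ j≤n with At-exists σ j (subst (j <_) (sym (size g)) j≤n)
... | w , h with w | h | inRange g h
... | suc v | h′ | _ = At⇒∈ (involutive g h′)

Involution-injective : ∀ {n σ} → Involution n σ → ∀ {i j v} → At σ i v → At σ j v → i ≡ j
Involution-injective g {v = zero} h₁ h₂ with () ← proj₁ (inRange g h₁)
Involution-injective g {v = suc v} h₁ h₂ =
  suc-injective (At-functional (involutive g h₁) (involutive g h₂))

Involution-unique : ∀ {n σ} → Involution n σ → Unique σ
Involution-unique g = distinct _ (Involution-injective g)
  where
  distinct : ∀ σ → (∀ {i j v} → At σ i v → At σ j v → i ≡ j) → Unique σ
  distinct []       inj = []
  distinct (x ∷ xs) inj =
    All.tabulate (λ m x≡y → fresh m x≡y) ∷ distinct xs (λ h₁ h₂ → suc-injective (inj (at-tail h₁) (at-tail h₂)))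
    where
    fresh : ∀ {y} → y ∈ xs → x ≢ y
    fresh m refl with () ← inj at-head (at-tail (proj₂ (∈⇒At m)))

Involution-∈ : ∀ {n σ} → Involution n σ → ∀ {v} → v ∈ σ → 1 ≤ v × v ≤ n
Involution-∈ g m = inRange g (proj₂ (∈⇒At m))

Involution-[] : Involution 0 []
Involution-[] = involution refl (λ ()) (λ ())

Involution-snoc : ∀ {m τ} → Involution m τ → Involution (suc m) (τ ++ suc m ∷ [])
Involution-snoc {m} {τ} g = involution len range inv
  where
  σ = τ ++ suc m ∷ []
  len : length σ ≡ suc m
  len = trans (length-++ τ) (trans (+-comm (length τ) 1) (cong suc (size g)))
  final : At σ m (suc m)
  final = At-last m τ (suc m) len
  range : InRange (suc m) σ
  range h with At-++⁻ τ h
  ... | inj₁ h₁                  = proj₁ (inRange g h₁) , m≤n⇒m≤1+n (proj₂ (inRange g h₁))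
  ... | inj₂ (_ , _ , at-head)   = s≤s z≤n , ≤-refl
  inv : Involutive σ
  inv h with At-++⁻ τ h
  ... | inj₁ h₁ = At-++ˡ (involutive g h₁)
  ... | inj₂ (zero , e , at-head) =
    subst (λ k → At σ m (suc k)) (sym (trans e (trans (+-identityʳ _) (size g)))) final

Involution-unsnoc : ∀ {n P} → Involution (suc n) (P ++ suc n ∷ []) → Involution n P
Involution-unsnoc {n} {P} g = involution len range inv
  where
  len : length P ≡ n
  len = suc-injective (trans (sym (+-comm (length P) 1)) (trans (sym (length-++ P)) (size g)))
  final : At (P ++ suc n ∷ []) n (suc n)
  final = At-last n P (suc n) (size g)
  range : InRange n P
  range {i} {v} h = proj₁ (inRange g (At-++ˡ h)) , ≤-pred (≤∧≢⇒< (proj₂ (inRange g (At-++ˡ h))) v≢n+1)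
    where
    v≢n+1 : v ≢ suc n
    v≢n+1 refl = <-irrefl (Involution-injective g (At-++ˡ h) final) (subst (i <_) len (At-bound h))
  inv : Involutive P
  inv {i} {v} h with At-++⁻ P (involutive g (At-++ˡ {ys = suc n ∷ []} h))
  ... | inj₁ h′ = h′
  ... | inj₂ (i′ , e , _) = ⊥-elim (<-irrefl refl (<-≤-trans v<|P| (subst (length P ≤_) (sym e) (m≤m+n _ i′))))
    where
    v<|P| : v < length P
    v<|P| = subst (v <_) (sym len) (proj₂ (range h))

Has132 : List ℕ → Set
Has132 σ = Σ ℕ λ a → Σ ℕ λ y → Σ ℕ λ z → (a ∷ y ∷ z ∷ []) ⊆ σ × a < z × z < y

⊆⇒∈subseqs : ∀ {s} xs → s ⊆ xs → s ∈ subseqs xs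
⊆⇒∈subseqs []       []         = here refl
⊆⇒∈subseqs (x ∷ xs) (_ ∷ʳ h)   = ∈-++⁺ʳ (map (x ∷_) (subseqs xs)) (⊆⇒∈subseqs xs h)
⊆⇒∈subseqs (x ∷ xs) (refl ∷ h) = ∈-++⁺ˡ (∈-map⁺ (x ∷_) (⊆⇒∈subseqs xs h))

∈subseqs⇒⊆ : ∀ {s} xs → s ∈ subseqs xs → s ⊆ xs
∈subseqs⇒⊆ []       (here refl) = []
∈subseqs⇒⊆ (x ∷ xs) m with ∈-++⁻ (map (x ∷_) (subseqs xs)) m
... | inj₂ m′ = x ∷ʳ ∈subseqs⇒⊆ xs m′
... | inj₁ m′ with ∈-map⁻ (x ∷_) m′
... | _ , m″ , refl = refl ∷ ∈subseqs⇒⊆ xs m″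

sameOrder132⇒ : ∀ a y z → T (sameOrder (a ∷ y ∷ z ∷ []) pat132) → a < z × z < y
sameOrder132⇒ a y z t rewrite <ᵇ-irrefl a | <ᵇ-irrefl y | <ᵇ-irrefl z with a <ᵇ y
... | false = ⊥-elim t
... | true with a <ᵇ z in a<z
... | false = ⊥-elim t
... | true with y <ᵇ a
... | true = ⊥-elim t
... | false with y <ᵇ z
... | true = ⊥-elim t
... | false with z <ᵇ a
... | true = ⊥-elim t
... | false with z <ᵇ y in z<y
... | false = ⊥-elim t
... | true = <ᵇ⇒< a z (subst T (sym a<z) tt) , <ᵇ⇒< z y (subst T (sym z<y) tt)

sameOrder132⇐ : ∀ {a y z} → a < z → z < y → T (sameOrder (a ∷ y ∷ z ∷ []) pat132)
sameOrder132⇐ {a} {y} {z} a<z z<y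
  rewrite <ᵇ-irrefl a | <ᵇ-irrefl y | <ᵇ-irrefl z
        | <⇒<ᵇ≡true a<z | <⇒<ᵇ≡true z<y | <⇒<ᵇ≡true (<-trans a<z z<y)
        | ≥⇒<ᵇ≡false (<⇒≤ (<-trans a<z z<y)) | ≥⇒<ᵇ≡false (<⇒≤ z<y) | ≥⇒<ᵇ≡false (<⇒≤ a<z) = tt

avoids132⇒ : ∀ σ → T (avoids σ pat132) → ¬ Has132 σ
avoids132⇒ σ t (a , y , z , s , a<z , z<y) =
  T-not⁻ t (AnyP.any⁺ _ (Any.map (λ { refl → sameOrder132⇐ a<z z<y }) (⊆⇒∈subseqs σ s)))

avoids132⇐ : ∀ σ → ¬ Has132 σ → T (avoids σ pat132)
avoids132⇐ σ no132 = T-not⁺ λ t → no132 (witness (find (AnyP.any⁻ _ (subseqs σ) t)))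
  where
  witness : (∃ λ s → s ∈ subseqs σ × T (sameOrder s pat132)) → Has132 σ
  witness ((a ∷ y ∷ z ∷ []) , m , t) = a , y , z , ∈subseqs⇒⊆ σ m , sameOrder132⇒ a y z t

⊆-++⁻ : ∀ (xs : List ℕ) {ys s} → s ⊆ (xs ++ ys) → ∃₂ λ s₁ s₂ → s ≡ s₁ ++ s₂ × s₁ ⊆ xs × s₂ ⊆ ys
⊆-++⁻ []       h          = [] , _ , refl , [] , h
⊆-++⁻ (x ∷ xs) (_ ∷ʳ h)   with s₁ , s₂ , refl , h₁ , h₂ ← ⊆-++⁻ xs h = s₁ , s₂ , refl , x ∷ʳ h₁ , h₂
⊆-++⁻ (x ∷ xs) (refl ∷ h) with s₁ , s₂ , refl , h₁ , h₂ ← ⊆-++⁻ xs h = x ∷ s₁ , s₂ , refl , refl ∷ h₁ , h₂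

⊆-map⁻ : ∀ (f : ℕ → ℕ) xs {s} → s ⊆ map f xs → ∃ λ s′ → s ≡ map f s′ × s′ ⊆ xs
⊆-map⁻ f []       []         = [] , refl , []
⊆-map⁻ f (x ∷ xs) (_ ∷ʳ h)   with s′ , refl , h′ ← ⊆-map⁻ f xs h = s′ , refl , x ∷ʳ h′
⊆-map⁻ f (x ∷ xs) (refl ∷ h) with s′ , refl , h′ ← ⊆-map⁻ f xs h = x ∷ s′ , refl , refl ∷ h′

Has132-++ˡ : ∀ {xs} ys → Has132 xs → Has132 (xs ++ ys)
Has132-++ˡ ys (a , y , z , s , h) = a , y , z , Sublist.++⁺ʳ ys s , h

Has132-++ʳ : ∀ xs {ys} → Has132 ys → Has132 (xs ++ ys)
Has132-++ʳ xs (a , y , z , s , h) = a , y , z , Sublist.++⁺ˡ xs s , h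

Has132-∷ : ∀ x {xs} → Has132 xs → Has132 (x ∷ xs)
Has132-∷ x = Has132-++ʳ (x ∷ [])

Has132-shift : ∀ c {xs} → Has132 xs → Has132 (map (_+ c) xs)
Has132-shift c (a , y , z , s , a<z , z<y) =
  a + c , y + c , z + c , Sublist.map⁺ (_+ c) s , +-monoˡ-< c a<z , +-monoˡ-< c z<y

Has132-unshift : ∀ c xs → Has132 (map (_+ c) xs) → Has132 xs
Has132-unshift c xs (a , y , z , s , a<z , z<y) with ⊆-map⁻ (_+ c) xs s
... | (a′ ∷ y′ ∷ z′ ∷ []) , refl , s′ = a′ , y′ , z′ , s′ , +-cancelʳ-< _ _ _ a<z , +-cancelʳ-< _ _ _ z<y

Straddles132 : List ℕ → List ℕ → Set
Straddles132 xs ys = Σ ℕ λ a → Σ ℕ λ y → Σ ℕ λ z →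
  a ∈ xs × (y ∈ xs ⊎ y ∈ ys) × z ∈ ys × a < z × z < y

Has132-++⁻ : ∀ xs {ys} → Has132 (xs ++ ys) → Has132 xs ⊎ Has132 ys ⊎ Straddles132 xs ys
Has132-++⁻ xs (a , y , z , s , h₁ , h₂) with ⊆-++⁻ xs s
... | [] , _ , refl , _ , s₂ = inj₂ (inj₁ (a , y , z , s₂ , h₁ , h₂))
... | (_ ∷ []) , _ , refl , s₁ , s₂ =
  inj₂ (inj₂ (a , y , z , lookup s₁ (here refl) , inj₂ (lookup s₂ (here refl)) , lookup s₂ (there (here refl)) , h₁ , h₂))
... | (_ ∷ _ ∷ []) , _ , refl , s₁ , s₂ =
  inj₂ (inj₂ (a , y , z , lookup s₁ (here refl) , inj₁ (lookup s₁ (there (here refl))) , lookup s₂ (here refl) , h₁ , h₂))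
... | (_ ∷ _ ∷ _ ∷ []) , [] , refl , s₁ , _ = inj₁ (a , y , z , s₁ , h₁ , h₂)

Has132-block⁻ : ∀ xs ys → (∀ {a z} → a ∈ xs → z ∈ ys → z < a) → Has132 (xs ++ ys) → Has132 xs ⊎ Has132 ys
Has132-block⁻ xs ys below p with Has132-++⁻ xs p
... | inj₁ q = inj₁ q
... | inj₂ (inj₁ q) = inj₂ q
... | inj₂ (inj₂ (_ , _ , _ , ma , _ , mz , a<z , _)) = ⊥-elim (<-asym a<z (below ma mz))

Has132-max∷⁻ : ∀ x xs → (∀ {z} → z ∈ xs → z < x) → Has132 (x ∷ xs) → Has132 xs
Has132-max∷⁻ x xs below (a , y , z , _ ∷ʳ s , h) = a , y , z , s , h
Has132-max∷⁻ x xs below (a , y , z , refl ∷ s , a<z , _) =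
  ⊥-elim (<-asym a<z (below (lookup s (there (here refl)))))

Has132-∷max⁻ : ∀ {m} τ → (∀ {v} → v ∈ τ → v ≤ m) → Has132 (τ ++ suc m ∷ []) → Has132 τ
Has132-∷max⁻ τ bounded p with Has132-++⁻ τ p
... | inj₁ q = q
... | inj₂ (inj₁ (_ , _ , _ , _ ∷ʳ () , _))
... | inj₂ (inj₁ (_ , _ , _ , refl ∷ () , _))
... | inj₂ (inj₂ (_ , _ , _ , _ , inj₁ my , here refl , _ , z<y)) = ⊥-elim (<-irrefl refl (<-≤-trans z<y (m≤n⇒m≤1+n (bounded my))))
... | inj₂ (inj₂ (_ , _ , _ , _ , inj₂ (here refl) , here refl , _ , z<y)) = ⊥-elim (<-irrefl refl z<y)

¬Has132-[] : ¬ Has132 []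
¬Has132-[] (_ , _ , _ , () , _)

Unique-concatMap : ∀ {A B : Set} (f : A → List B) {xs : List A} → Unique xs →
  (∀ {x} → x ∈ xs → Unique (f x)) →
  (∀ {x y z} → x ∈ xs → y ∈ xs → z ∈ f x → z ∈ f y → x ≡ y) →
  Unique (concatMap f xs)
Unique-concatMap f {[]}     _          _        _        = []
Unique-concatMap f {x ∷ xs} (x∉ ∷ uxs) uniqueFx disjoint =
  Unique.++⁺ (uniqueFx (here refl))
             (Unique-concatMap f uxs (uniqueFx ∘ there) (λ m₁ m₂ → disjoint (there m₁) (there m₂)))
             separated
  where
  separated : ∀ {v} → ¬ (v ∈ f x × v ∈ concatMap f xs)
  separated (m₁ , m₂) with y , my , m₂′ ← find (∈-concatMap⁻ f {xs} m₂)
    with refl ← disjoint (here refl) (there my) m₁ m₂′ = All.lookup x∉ my refl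

∈-remove : ∀ {A : Set} {v x : A} (a b : List A) → v ∈ a ++ x ∷ b → v ≢ x → v ∈ a ++ b
∈-remove []      b (here refl) v≢x = ⊥-elim (v≢x refl)
∈-remove []      b (there m)   _   = m
∈-remove (y ∷ a) b (here refl) _   = here refl
∈-remove (y ∷ a) b (there m)   v≢x = there (∈-remove a b m v≢x)

Unique-remove : ∀ {A : Set} {x : A} (a b : List A) → Unique (a ++ x ∷ b) → Unique (a ++ b) × x ∉ a ++ b
Unique-remove []      b (x∉ ∷ u) = u , λ m → All.lookup x∉ m refl
Unique-remove {x = x} (y ∷ a) b (y∉ ∷ u) with u′ , x∉ ← Unique-remove a b u =
  All.tabulate (λ m → All.lookup y∉ (reinsert a m)) ∷ u′ , x∉′
  where
  reinsert : ∀ {v} a → v ∈ a ++ b → v ∈ a ++ x ∷ b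
  reinsert []      m         = there m
  reinsert (z ∷ a) (here p)  = here p
  reinsert (z ∷ a) (there m) = there (reinsert a m)
  x∉′ : x ∉ y ∷ a ++ b
  x∉′ (here refl) = All.lookup y∉ (∈-insert a) refl
  x∉′ (there m)   = x∉ m

Unique-same-members-↭ : ∀ {A : Set} {xs ys : List A} → Unique xs → Unique ys →
  (∀ {x} → x ∈ xs → x ∈ ys) → (∀ {x} → x ∈ ys → x ∈ xs) → xs ↭ ys
Unique-same-members-↭ uxs uys to from = ∼bag⇒↭ (unique∧set⇒bag uxs uys (mk⇔ to from))

insertEverywhere⁻ : ∀ (x : ℕ) ys {τ} → τ ∈ insertEverywhere x ys → ∃₂ λ a b → ys ≡ a ++ b × τ ≡ a ++ x ∷ b
insertEverywhere⁻ x []       (here refl) = [] , [] , refl , refl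
insertEverywhere⁻ x (y ∷ ys) (here refl) = [] , y ∷ ys , refl , refl
insertEverywhere⁻ x (y ∷ ys) (there m) with _ , m′ , refl ← ∈-map⁻ (y ∷_) m
  with a , b , refl , refl ← insertEverywhere⁻ x ys m′ = y ∷ a , b , refl , refl

insertEverywhere⁺ : ∀ (x : ℕ) a b → (a ++ x ∷ b) ∈ insertEverywhere x (a ++ b)
insertEverywhere⁺ x []      []      = here refl
insertEverywhere⁺ x []      (y ∷ b) = here refl
insertEverywhere⁺ x (y ∷ a) b       = there (∈-map⁺ (y ∷_) (insertEverywhere⁺ x a b))

insert-cancel : ∀ (x : ℕ) (a b c d : List ℕ) → x ∉ a ++ b → x ∉ c ++ d → a ++ x ∷ b ≡ c ++ x ∷ d → a ++ b ≡ c ++ d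
insert-cancel x []      b []      d _  _  refl = refl
insert-cancel x []      b (y ∷ c) d _  x∉ e with refl , _ ← ∷-injective e = ⊥-elim (x∉ (here refl))
insert-cancel x (y ∷ a) b []      d x∉ _  refl = ⊥-elim (x∉ (here refl))
insert-cancel x (y ∷ a) b (_ ∷ c) d x∉ x∉′ e with refl , e′ ← ∷-injective e =
  cong (y ∷_) (insert-cancel x a b c d (x∉ ∘ there) (x∉′ ∘ there) e′)

Unique-insertEverywhere : ∀ x ys → x ∉ ys → Unique (insertEverywhere x ys)
Unique-insertEverywhere x []       _  = [] ∷ []
Unique-insertEverywhere x (y ∷ ys) x∉ =
  All.tabulate front ∷ Unique.map⁺ (λ { refl → refl }) (Unique-insertEverywhere x ys (x∉ ∘ there))
  where
  front : ∀ {τ} → τ ∈ map (y ∷_) (insertEverywhere x ys) → (x ∷ y ∷ ys) ≢ τ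
  front m e with _ , _ , refl ← ∈-map⁻ (y ∷_) m with refl ← e = x∉ (here refl)

perms⇒ : ∀ n {σ} → σ ∈ perms n → length σ ≡ n × (∀ {v} → v ∈ σ → 1 ≤ v × v ≤ n)
perms⇒ zero (here refl) = refl , λ ()
perms⇒ (suc n) {σ} m with τ , mτ , mσ ← find (∈-concatMap⁻ (insertEverywhere (suc n)) {perms n} m)
  with a , b , refl , refl ← insertEverywhere⁻ (suc n) τ mσ
  with len , range ← perms⇒ n mτ = len′ , range′
  where
  len′ : length (a ++ suc n ∷ b) ≡ suc n
  len′ = trans (length-++ a) (trans (+-suc (length a) (length b)) (cong suc (trans (sym (length-++ a)) len)))
  range′ : ∀ {v} → v ∈ a ++ suc n ∷ b → 1 ≤ v × v ≤ suc n
  range′ {v} mv with v ≟ suc n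
  ... | yes refl = s≤s z≤n , ≤-refl
  ... | no v≢n+1 = let lo , hi = range (∈-remove a b mv v≢n+1) in lo , m≤n⇒m≤1+n hi

perms⇐ : ∀ n σ → length σ ≡ n → (∀ {j} → 1 ≤ j → j ≤ n → j ∈ σ) → σ ∈ perms n
perms⇐ zero    []  _   _    = here refl
perms⇐ (suc n) σ   len onto with a , b , refl ← ∈-∃++ (onto (s≤s z≤n) ≤-refl) =
  ∈-concatMap⁺ (insertEverywhere (suc n)) {perms n}
    (Any.map (λ { refl → insertEverywhere⁺ (suc n) a b }) (perms⇐ n (a ++ b) len′ onto′))
  where
  len′ : length (a ++ b) ≡ n
  len′ = suc-injective (trans (cong suc (length-++ a))
           (trans (sym (+-suc (length a) (length b))) (trans (sym (length-++ a)) len)))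
  onto′ : ∀ {j} → 1 ≤ j → j ≤ n → j ∈ a ++ b
  onto′ p q = ∈-remove a b (onto p (m≤n⇒m≤1+n q)) (λ e → 1+n≰n (subst (_≤ n) e q))

Unique-perms : ∀ n → Unique (perms n)
Unique-perms zero    = [] ∷ []
Unique-perms (suc n) = Unique-concatMap (insertEverywhere (suc n)) (Unique-perms n) fresh-unique same-source
  where
  fresh : ∀ {σ} → σ ∈ perms n → suc n ∉ σ
  fresh m m′ = 1+n≰n (proj₂ (proj₂ (perms⇒ n m) m′))
  fresh-unique : ∀ {σ} → σ ∈ perms n → Unique (insertEverywhere (suc n) σ)
  fresh-unique m = Unique-insertEverywhere (suc n) _ (fresh m)
  same-source : ∀ {x y z} → x ∈ perms n → y ∈ perms n →
                z ∈ insertEverywhere (suc n) x → z ∈ insertEverywhere (suc n) y → x ≡ y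
  same-source {x} {y} mx my mz₁ mz₂
    with a , b , refl , refl ← insertEverywhere⁻ (suc n) x mz₁
    with c , d , refl , e ← insertEverywhere⁻ (suc n) y mz₂ = insert-cancel (suc n) a b c d (fresh mx) (fresh my) e

perms∩involution⇒ : ∀ n {σ} → σ ∈ perms n → T (isInvolution σ) → Involution n σ
perms∩involution⇒ n {σ} m t with len , range ← perms⇒ n m =
  involution len (range ∘ At⇒∈) (isInvolution⇒ σ (subst (λ k → InRange k σ) (sym len) (range ∘ At⇒∈)) t)

involution⇒perms : ∀ {n σ} → Involution n σ → σ ∈ perms n × T (isInvolution σ)
involution⇒perms {n} {σ} g =
  perms⇐ n σ (size g) (Involution-onto g) ,
  isInvolution⇐ σ (subst (λ k → InRange k σ) (sym (size g)) (inRange g)) (involutive g)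

I132⁻ : ∀ n {σ} → σ ∈ I132 n → Involution n σ × ¬ Has132 σ
I132⁻ n {σ} m with mp , t ← ∈-filter⁻ (λ σ → T? (isInvolution σ ∧ avoids σ pat132)) {xs = perms n} m
  with t₁ , t₂ ← Equivalence.to (T-∧ {isInvolution σ}) t = perms∩involution⇒ n mp t₁ , avoids132⇒ σ t₂

I132⁺ : ∀ n {σ} → Involution n σ → ¬ Has132 σ → σ ∈ I132 n
I132⁺ n {σ} g no132 with mp , t ← involution⇒perms g =
  ∈-filter⁺ (λ σ → T? (isInvolution σ ∧ avoids σ pat132)) mp (Equivalence.from T-∧ (t , avoids132⇐ σ no132))

FI132⁻ : ∀ n {σ} → σ ∈ FI132 n → Involution n σ × FixedPointFree σ × ¬ Has132 σ
FI132⁻ n {σ} m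
  with mp , t ← ∈-filter⁻ (λ σ → T? (isInvolution σ ∧ isFixedPointFree σ ∧ avoids σ pat132)) {xs = perms n} m
  with t₁ , t₂₃ ← Equivalence.to (T-∧ {isInvolution σ}) t
  with t₂ , t₃ ← Equivalence.to (T-∧ {isFixedPointFree σ}) t₂₃ =
  perms∩involution⇒ n mp t₁ , isFixedPointFree⇒ σ t₂ , avoids132⇒ σ t₃

FI132⁺ : ∀ n {σ} → Involution n σ → FixedPointFree σ → ¬ Has132 σ → σ ∈ FI132 n
FI132⁺ n {σ} g fp no132 with mp , t ← involution⇒perms g =
  ∈-filter⁺ (λ σ → T? (isInvolution σ ∧ isFixedPointFree σ ∧ avoids σ pat132)) mp
    (Equivalence.from T-∧ (t , Equivalence.from T-∧ (isFixedPointFree⇐ σ fp , avoids132⇐ σ no132)))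

Unique-I132 : ∀ n → Unique (I132 n)
Unique-I132 n = Unique.filter⁺ (λ σ → T? (isInvolution σ ∧ avoids σ pat132)) (Unique-perms n)

Unique-FI132 : ∀ n → Unique (FI132 n)
Unique-FI132 n = Unique.filter⁺ (λ σ → T? (isInvolution σ ∧ isFixedPointFree σ ∧ avoids σ pat132)) (Unique-perms n)

-- The ascent statistics by recursion on the list.  ascBit x y records whether
-- x y is an ascent; dropping the first entry shifts all ascent positions down by one.

ascBit : ℕ → ℕ → ℕ
ascBit x y = if x <ᵇ y then 1 else 0

ascents : List ℕ → ℕ
ascents (x ∷ y ∷ r) = ascBit x y + ascents (y ∷ r)
ascents _           = 0

comajor : List ℕ → ℕ
comajor (x ∷ y ∷ r) = ascBit x y + (comajor (y ∷ r) + ascents (y ∷ r))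
comajor _           = 0

filter-map-suc : ∀ (Q : ℕ → Bool) xs →
  filter (λ i → T? (Q i)) (map suc xs) ≡ map suc (filter (λ i → T? (Q (suc i))) xs)
filter-map-suc Q []       = refl
filter-map-suc Q (x ∷ xs) with Q (suc x)
... | true  = cong (suc x ∷_) (filter-map-suc Q xs)
... | false = filter-map-suc Q xs

Asc-tail : ∀ x y r →
  filter (λ i → T? (app (x ∷ y ∷ r) i <ᵇ app (x ∷ y ∷ r) (suc i))) (map suc (applyUpTo suc (length r)))
  ≡ map suc (Asc (y ∷ r))
Asc-tail x y r = begin
  filter (λ i → T? (Q i)) (map suc (applyUpTo suc (length r)))
    ≡⟨ cong (λ t → filter (λ i → T? (Q i)) (map suc t)) (sym (map-applyUpTo (λ i → i) suc (length r))) ⟩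
  filter (λ i → T? (Q i)) (map suc (map suc (upTo (length r))))
    ≡⟨ filter-map-suc Q (map suc (upTo (length r))) ⟩
  map suc (filter (λ i → T? (Q (suc i))) (map suc (upTo (length r))))
    ≡⟨ cong (map suc) (filter-map-suc (λ i → Q (suc i)) (upTo (length r))) ⟩
  map suc (map suc (filter (λ i → T? (Q′ (suc i))) (upTo (length r))))
    ≡⟨ cong (map suc) (sym (filter-map-suc Q′ (upTo (length r)))) ⟩
  map suc (Asc (y ∷ r)) ∎
  where
  open ≡-Reasoning
  Q : ℕ → Bool
  Q i = app (x ∷ y ∷ r) i <ᵇ app (x ∷ y ∷ r) (suc i)
  Q′ : ℕ → Bool
  Q′ i = app (y ∷ r) i <ᵇ app (y ∷ r) (suc i)

Asc-∷ : ∀ x y r → Asc (x ∷ y ∷ r) ≡ (if x <ᵇ y then 1 ∷ map suc (Asc (y ∷ r)) else map suc (Asc (y ∷ r)))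
Asc-∷ x y r with x <ᵇ y
... | true  = cong (1 ∷_) (Asc-tail x y r)
... | false = Asc-tail x y r

sum-map-suc : ∀ L → sum (map suc L) ≡ sum L + length L
sum-map-suc []      = refl
sum-map-suc (x ∷ L) = trans (cong (suc x +_) (sum-map-suc L)) (shuffle x (sum L) (length L))
  where
  shuffle : ∀ x s l → suc x + (s + l) ≡ x + s + suc l
  shuffle = solve-∀

length-shifted : ∀ x y (A : List ℕ) →
  length (if x <ᵇ y then 1 ∷ map suc A else map suc A) ≡ ascBit x y + length A
length-shifted x y A with x <ᵇ y
... | true  = cong suc (length-map suc A)
... | false = length-map suc A

sum-shifted : ∀ x y (A : List ℕ) →
  sum (if x <ᵇ y then 1 ∷ map suc A else map suc A) ≡ ascBit x y + (sum A + length A)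
sum-shifted x y A with x <ᵇ y
... | true  = cong suc (sum-map-suc A)
... | false = sum-map-suc A

asc≡ascents : ∀ σ → asc σ ≡ ascents σ
asc≡ascents []          = refl
asc≡ascents (x ∷ [])    = refl
asc≡ascents (x ∷ y ∷ r) =
  trans (cong length (Asc-∷ x y r))
        (trans (length-shifted x y (Asc (y ∷ r))) (cong (ascBit x y +_) (asc≡ascents (y ∷ r))))

comaj≡comajor : ∀ σ → comaj σ ≡ comajor σ
comaj≡comajor []          = refl
comaj≡comajor (x ∷ [])    = refl
comaj≡comajor (x ∷ y ∷ r) =
  trans (cong sum (Asc-∷ x y r))
        (trans (sum-shifted x y (Asc (y ∷ r)))
               (cong (ascBit x y +_) (cong₂ _+_ (comaj≡comajor (y ∷ r)) (asc≡ascents (y ∷ r)))))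

-- Concatenation: the statistics of xs ++ ys are those of the parts plus the
-- possible ascent at the junction (last of xs, first of ys), which sits at
-- position |xs| and shifts the ascents of ys by |xs|.
junction : List ℕ → List ℕ → ℕ
junction []           _       = 0
junction (x ∷ [])     []      = 0
junction (x ∷ [])     (y ∷ _) = ascBit x y
junction (x ∷ x′ ∷ xs) ys     = junction (x′ ∷ xs) ys

ascents-++ : ∀ xs ys → ascents (xs ++ ys) ≡ ascents xs + junction xs ys + ascents ys
ascents-++ []            ys       = refl
ascents-++ (x ∷ [])      []       = refl
ascents-++ (x ∷ [])      (y ∷ ys) = refl
ascents-++ (x ∷ x′ ∷ xs) ys       =
  trans (cong (ascBit x x′ +_) (ascents-++ (x′ ∷ xs) ys))
        (regroup (ascBit x x′) (ascents (x′ ∷ xs)) (junction (x′ ∷ xs) ys) (ascents ys))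
  where
  regroup : ∀ b a j c → b + (a + j + c) ≡ b + a + j + c
  regroup = solve-∀

comajor-++ : ∀ xs ys →
  comajor (xs ++ ys) ≡ comajor xs + junction xs ys * length xs + (comajor ys + length xs * ascents ys)
comajor-++ []            ys       = sym (+-identityʳ (comajor ys))
comajor-++ (x ∷ [])      []       = refl
comajor-++ (x ∷ [])      (y ∷ ys) = regroup (ascBit x y) (comajor (y ∷ ys)) (ascents (y ∷ ys))
  where
  regroup : ∀ b c a → b + (c + a) ≡ 0 + b * 1 + (c + 1 * a)
  regroup = solve-∀
comajor-++ (x ∷ x′ ∷ xs) ys       =
  trans (cong₂ (λ u v → ascBit x x′ + (u + v)) (comajor-++ (x′ ∷ xs) ys) (ascents-++ (x′ ∷ xs) ys))
        (regroup (ascBit x x′) (comajor (x′ ∷ xs)) (ascents (x′ ∷ xs)) (junction (x′ ∷ xs) ys)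
                 (length (x′ ∷ xs)) (comajor ys) (ascents ys))
  where
  regroup : ∀ b c a j l cy ay →
    b + ((c + j * l + (cy + l * ay)) + (a + j + ay)) ≡ (b + (c + a)) + j * suc l + (cy + suc l * ay)
  regroup = solve-∀

nonEmpty : List ℕ → ℕ
nonEmpty []      = 0
nonEmpty (_ ∷ _) = 1

nonEmpty-length : ∀ (xs : List ℕ) {m} → length xs ≡ suc m → nonEmpty xs ≡ 1
nonEmpty-length (x ∷ xs) _ = refl

junction-ascent : ∀ xs {y ys} → (∀ {v} → v ∈ xs → v < y) → junction xs (y ∷ ys) ≡ nonEmpty xs
junction-ascent []            below = refl
junction-ascent (x ∷ [])      below rewrite <⇒<ᵇ≡true (below (here refl)) = refl
junction-ascent (x ∷ x′ ∷ xs) below = junction-ascent (x′ ∷ xs) (below ∘ there)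

junction-descent : ∀ xs ys → (∀ {v z} → v ∈ xs → z ∈ ys → z < v) → junction xs ys ≡ 0
junction-descent []            ys       above = refl
junction-descent (x ∷ [])      []       above = refl
junction-descent (x ∷ [])      (y ∷ ys) above rewrite ≥⇒<ᵇ≡false (<⇒≤ (above (here refl) (here refl))) = refl
junction-descent (x ∷ x′ ∷ xs) ys       above = junction-descent (x′ ∷ xs) ys (above ∘ there)

ascBit-shift : ∀ c x y → ascBit (x + c) (y + c) ≡ ascBit x y
ascBit-shift c x y with <-cmp x y
... | tri< x<y _ _ rewrite <⇒<ᵇ≡true x<y | <⇒<ᵇ≡true (+-monoˡ-< c x<y) = refl
... | tri≈ _ refl _ rewrite <ᵇ-irrefl x | <ᵇ-irrefl (x + c) = refl
... | tri> _ _ y<x rewrite ≥⇒<ᵇ≡false (<⇒≤ y<x) | ≥⇒<ᵇ≡false (<⇒≤ (+-monoˡ-< c y<x)) = refl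

ascents-shift : ∀ c xs → ascents (map (_+ c) xs) ≡ ascents xs
ascents-shift c []           = refl
ascents-shift c (x ∷ [])     = refl
ascents-shift c (x ∷ y ∷ xs) = cong₂ _+_ (ascBit-shift c x y) (ascents-shift c (y ∷ xs))

comajor-shift : ∀ c xs → comajor (map (_+ c) xs) ≡ comajor xs
comajor-shift c []           = refl
comajor-shift c (x ∷ [])     = refl
comajor-shift c (x ∷ y ∷ xs) =
  cong₂ _+_ (ascBit-shift c x y) (cong₂ _+_ (comajor-shift c (y ∷ xs)) (ascents-shift c (y ∷ xs)))

ascents-snoc-max : ∀ τ N → (∀ {v} → v ∈ τ → v < N) → ascents (τ ++ N ∷ []) ≡ ascents τ + nonEmpty τ
ascents-snoc-max τ N below =
  trans (ascents-++ τ (N ∷ [])) (trans (+-identityʳ _) (cong (ascents τ +_) (junction-ascent τ below)))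

comajor-snoc-max : ∀ τ N → (∀ {v} → v ∈ τ → v < N) →
  comajor (τ ++ N ∷ []) ≡ comajor τ + nonEmpty τ * length τ
comajor-snoc-max τ N below =
  trans (comajor-++ τ (N ∷ []))
        (trans (cong (λ t → comajor τ + t * length τ + (0 + length τ * 0)) (junction-ascent τ below))
               (simplify (comajor τ) (nonEmpty τ) (length τ)))
  where
  simplify : ∀ a b c → a + b * c + (0 + c * 0) ≡ a + b * c
  simplify = solve-∀

-- Every 132-avoiding involution whose maximum x is not its last entry has the shape
--   P , x , Mi , B , y
-- (a prefix, the maximum, a middle block, a bottom block, a last entry).
fiveBlocks : List ℕ → ℕ → List ℕ → List ℕ → ℕ → List ℕ
fiveBlocks P x Mi B y = P ++ x ∷ (Mi ++ (B ++ y ∷ []))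

module FiveBlocks (P : List ℕ) (x : ℕ) (Mi B : List ℕ) (y : ℕ)
                  {a b c : ℕ} (|P| : length P ≡ a) (|Mi| : length Mi ≡ b) (|B| : length B ≡ c) where

  σ : List ℕ
  σ = fiveBlocks P x Mi B y

  atP : ∀ {i v} → At P i v → At σ i v
  atP = At-++ˡ

  atX : At σ a x
  atX = subst (λ k → At σ k x) (trans (+-identityʳ _) |P|) (At-++ʳ P at-head)

  atM : ∀ {i v} → At Mi i v → At σ (suc (a + i)) v
  atM {i} {v} h = subst (λ k → At σ k v) (trans (+-suc _ i) (cong (λ t → suc (t + i)) |P|))
                        (At-++ʳ P (at-tail (At-++ˡ h)))

  atB : ∀ {i v} → At B i v → At σ (suc (a + (b + i))) v
  atB {i} {v} h = subst (λ k → At σ k v) (trans (+-suc _ _) (cong₂ (λ s t → suc (s + (t + i))) |P| |Mi|))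
                        (At-++ʳ P (at-tail (At-++ʳ Mi (At-++ˡ h))))

  atY : At σ (suc (a + (b + c))) y
  atY = subst (λ k → At σ k y) position (At-++ʳ P (at-tail (At-++ʳ Mi (At-++ʳ B at-head))))
    where
    position : length P + suc (length Mi + (length B + 0)) ≡ suc (a + (b + c))
    position = trans (+-suc _ _) (cong₃ |P| |Mi| (trans (+-identityʳ _) |B|))
      where
      cong₃ : ∀ {p p′ m m′ q q′} → p ≡ p′ → m ≡ m′ → q ≡ q′ → suc (p + (m + q)) ≡ suc (p′ + (m′ + q′))
      cong₃ refl refl refl = refl

  data Entry (i v : ℕ) : Set where
    inP : At P i v → Entry i v
    isX : i ≡ a → v ≡ x → Entry i v
    inM : ∀ {i′} → i ≡ suc (a + i′) → At Mi i′ v → Entry i v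
    inB : ∀ {i′} → i ≡ suc (a + (b + i′)) → At B i′ v → Entry i v
    isY : i ≡ suc (a + (b + c)) → v ≡ y → Entry i v

  entry : ∀ {i v} → At σ i v → Entry i v
  entry h with At-++⁻ P h
  ... | inj₁ h₁ = inP h₁
  ... | inj₂ (zero , e , at-head) = isX (trans e (trans (+-identityʳ _) |P|)) refl
  ... | inj₂ (suc i′ , e , at-tail h₂) with At-++⁻ Mi h₂
  ... | inj₁ h₃ = inM (trans e (trans (+-suc _ i′) (cong (λ t → suc (t + i′)) |P|))) h₃
  ... | inj₂ (i₃ , e₃ , h₄) with At-++⁻ B h₄
  ... | inj₁ h₅ = inB (trans e (trans (+-suc _ _) (cong₂ (λ s t → suc (s + t)) |P| (trans e₃ (cong (_+ _) |Mi|))))) h₅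
  ... | inj₂ (i₄ , e₄ , at-head) =
    isY (trans e (trans (+-suc _ _) (cong₂ (λ s t → suc (s + t)) |P|
          (trans e₃ (cong₂ _+_ |Mi| (trans e₄ (trans (+-identityʳ _) |B|))))))) refl

  atP⁻ : ∀ {i v} → i < a → At σ i v → At P i v
  atP⁻ i<a h with w , h′ ← At-exists P _ (subst (_ <_) (sym |P|) i<a)
    with refl ← At-functional h (atP h′) = h′

  atM⁻ : ∀ {i v} → i < b → At σ (suc (a + i)) v → At Mi i v
  atM⁻ i<b h with w , h′ ← At-exists Mi _ (subst (_ <_) (sym |Mi|) i<b)
    with refl ← At-functional h (atM h′) = h′

  atB⁻ : ∀ {i v} → i < c → At σ (suc (a + (b + i))) v → At B i v
  atB⁻ i<c h with w , h′ ← At-exists B _ (subst (_ <_) (sym |B|) i<c)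
    with refl ← At-functional h (atB h′) = h′

assemble : ℕ → ℕ → ℕ → List ℕ → List ℕ → List ℕ → List ℕ
assemble N j r H1 τ H2 = fiveBlocks (map (_+ suc r) H1) N (map (_+ suc j) τ) H2 (suc j)

record Assembly (N j r : ℕ) (H1 τ H2 : List ℕ) : Set where
  field
    top-size    : length H1 ≡ j
    bottom-size : length H2 ≡ j
    total       : N ≡ suc (suc (j + j + r))
    τ-inv       : Involution r τ
    τ-avoids    : ¬ Has132 τ
    φ-inv       : Involution (j + j) (H1 ++ H2)
    φ-fpf       : FixedPointFree (H1 ++ H2)
    φ-avoids    : ¬ Has132 (H1 ++ H2)
    top-high    : ∀ {v} → v ∈ H1 → j < v
    bottom-low  : ∀ {v} → v ∈ H2 → v ≤ j

module AssemblySound {N j r : ℕ} {H1 τ H2 : List ℕ} (d : Assembly N j r H1 τ H2) where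
  open Assembly d

  P Mm : List ℕ
  P  = map (_+ suc r) H1
  Mm = map (_+ suc j) τ

  |H1| : length P ≡ j
  |H1| = trans (length-map _ H1) top-size

  |τ| : length Mm ≡ r
  |τ| = trans (length-map _ τ) (size τ-inv)

  open FiveBlocks P N Mm H2 (suc j) |H1| |τ| bottom-size

  φ-range : ∀ {v} → v ∈ H1 ++ H2 → 1 ≤ v × v ≤ j + j
  φ-range = Involution-∈ φ-inv

  τ-range : ∀ {v} → v ∈ τ → 1 ≤ v × v ≤ r
  τ-range = Involution-∈ τ-inv

  size-σ : length σ ≡ N
  size-σ = begin
    length σ                               ≡⟨ length-++ P ⟩
    length P + suc (length (Mm ++ (H2 ++ suc j ∷ []))) ≡⟨ cong (λ t → length P + suc t) (length-++ Mm) ⟩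
    length P + suc (length Mm + length (H2 ++ suc j ∷ [])) ≡⟨ cong (λ t → length P + suc (length Mm + t)) (length-++ H2) ⟩
    length P + suc (length Mm + (length H2 + 1)) ≡⟨ cong₂ (λ x y → x + suc y) |H1| (cong₂ (λ x y → x + (y + 1)) |τ| bottom-size) ⟩
    j + suc (r + (j + 1))                  ≡⟨ count j r ⟩
    suc (suc (j + j + r))                  ≡⟨ sym total ⟩
    N                                      ∎
    where
    open ≡-Reasoning
    count : ∀ j r → j + suc (r + (j + 1)) ≡ suc (suc (j + j + r))
    count = solve-∀

  P-high : ∀ {v} → v ∈ P → suc (suc (j + r)) ≤ v
  P-high m with w , mw , refl ← ∈-map⁻ (_+ suc r) m =
    subst (_≤ w + suc r) (cong suc (+-suc j r)) (+-monoˡ-≤ (suc r) (top-high mw))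

  Mm-range : ∀ {v} → v ∈ Mm → suc (suc j) ≤ v × v ≤ suc (j + r)
  Mm-range m with w , mw , refl ← ∈-map⁻ (_+ suc j) m =
    +-monoˡ-≤ (suc j) (proj₁ (τ-range mw)) ,
    subst (w + suc j ≤_) (trans (+-suc r j) (cong suc (+-comm r j))) (+-monoˡ-≤ (suc j) (proj₂ (τ-range mw)))

  tail-low : ∀ {v} → v ∈ H2 ++ suc j ∷ [] → v ≤ suc j
  tail-low m with ∈-++⁻ H2 m
  ... | inj₁ m′         = m≤n⇒m≤1+n (bottom-low m′)
  ... | inj₂ (here refl) = ≤-refl

  after-max-low : ∀ {v} → v ∈ Mm ++ (H2 ++ suc j ∷ []) → v ≤ suc (j + r)
  after-max-low m with ∈-++⁻ Mm m
  ... | inj₁ m′ = proj₂ (Mm-range m′)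
  ... | inj₂ m′ = ≤-trans (tail-low m′) (s≤s (m≤m+n j r))

  N-high : suc (suc (j + r)) ≤ N
  N-high = subst (suc (suc (j + r)) ≤_) (sym total) (s≤s (s≤s (+-monoˡ-≤ r (m≤n+m j j))))

  inRange-σ : InRange N σ
  inRange-σ h with entry h
  ... | inP h₁ with w , hw , refl ← At-map⁻ (_+ suc r) h₁ =
    ≤-trans (s≤s z≤n) (m≤n+m (suc r) w) ,
    ≤-trans (+-monoˡ-≤ (suc r) (proj₂ (φ-range (∈-++⁺ˡ (At⇒∈ hw)))))
            (subst (_≤ N) (sym (+-suc (j + j) r)) (subst (suc (j + j + r) ≤_) (sym total) (n≤1+n _)))
  ... | isX _ refl = subst (1 ≤_) (sym total) (s≤s z≤n) , ≤-refl
  ... | inM _ h₁ = let lo , hi = Mm-range (At⇒∈ h₁) in ≤-trans (s≤s z≤n) lo , ≤-trans hi (≤-trans (n≤1+n _) N-high)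
  ... | inB _ h₁ = proj₁ (φ-range (∈-++⁺ʳ H1 (At⇒∈ h₁))) ,
                   ≤-trans (bottom-low (At⇒∈ h₁)) (≤-trans (n≤1+n j) (≤-trans (s≤s (m≤m+n j r)) (≤-trans (n≤1+n _) N-high)))
  ... | isY _ refl = s≤s z≤n , ≤-trans (s≤s (m≤m+n j r)) (≤-trans (n≤1+n _) N-high)

  -- Involutivity, block by block: P ↔ B through φ, the maximum ↔ the last entry,
  -- and the middle block through τ.
  top-matched : ∀ {i v} → At P i (suc v) → At σ v (suc i)
  top-matched {i} {v} h with w , hw , e ← At-map⁻ (_+ suc r) h with w | hw | top-high (At⇒∈ hw) | e
  ... | suc w′ | hw′ | j<w | e′ with At-++⁻ H1 (involutive φ-inv (At-++ˡ {ys = H2} hw′))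
  ... | inj₁ h₃ = ⊥-elim (<-irrefl refl (<-≤-trans (subst (w′ <_) top-size (At-bound h₃)) (≤-pred j<w)))
  ... | inj₂ (i″ , e₂ , h₃) = subst (λ k → At σ k (suc i)) position (atB h₃)
    where
    shuffle : ∀ j i r → j + i + suc r ≡ suc (j + (r + i))
    shuffle = solve-∀
    position : suc (j + (r + i″)) ≡ v
    position = sym (trans (suc-injective e′) (trans (cong (_+ suc r) (trans e₂ (cong (_+ i″) top-size))) (shuffle j i″ r)))

  middle-matched : ∀ {i v} → At Mm i (suc v) → At σ v (suc (suc (j + i)))
  middle-matched {i} {v} h with w , hw , e ← At-map⁻ (_+ suc j) h with w | hw | proj₁ (τ-range (At⇒∈ hw)) | e
  ... | suc w′ | hw′ | _ | e′ = subst₂ (At σ) position value (atM (At-map (_+ suc j) (involutive τ-inv hw′)))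
    where
    shuffle₁ : ∀ w j → w + suc j ≡ suc (j + w)
    shuffle₁ = solve-∀
    shuffle₂ : ∀ i j → suc i + suc j ≡ suc (suc (j + i))
    shuffle₂ = solve-∀
    position : suc (j + w′) ≡ v
    position = sym (trans (suc-injective e′) (shuffle₁ w′ j))
    value : suc i + suc j ≡ suc (suc (j + i))
    value = shuffle₂ i j

  bottom-matched : ∀ {i v} → At H2 i (suc v) → At σ v (suc (suc (j + (r + i))))
  bottom-matched {i} {v} h with At-++⁻ H1 (involutive φ-inv (At-++ʳ H1 h))
  ... | inj₁ h₃ = subst (At σ v) value (atP (At-map (_+ suc r) h₃))
    where
    shuffle : ∀ j i r → suc (j + i) + suc r ≡ suc (suc (j + (r + i)))
    shuffle = solve-∀
    value : suc (length H1 + i) + suc r ≡ suc (suc (j + (r + i)))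
    value = trans (cong (λ t → suc (t + i) + suc r) top-size) (shuffle j i r)
  ... | inj₂ (i″ , e , _) =
    ⊥-elim (<-irrefl refl (≤-trans (bottom-low (At⇒∈ h)) (subst (_≤ v) top-size (subst (length H1 ≤_) (sym e) (m≤m+n _ i″)))))

  involutive-σ : Involutive σ
  involutive-σ {i} {v} h with entry h
  ... | inP h₁ = top-matched h₁
  ... | inM i≡ h₁ = subst (λ k → At σ v (suc k)) (sym i≡) (middle-matched h₁)
  ... | inB i≡ h₁ = subst (λ k → At σ v (suc k)) (sym i≡) (bottom-matched h₁)
  ... | isX i≡j v+1≡N = subst₂ (At σ) position (cong suc (sym i≡j)) atY
    where
    shuffle : ∀ j r → suc (j + j + r) ≡ suc (j + (r + j))
    shuffle = solve-∀
    position : suc (j + (r + j)) ≡ v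
    position = sym (suc-injective (trans v+1≡N (trans total (cong suc (shuffle j r)))))
  ... | isY i≡ v+1≡j+1 = subst₂ (At σ) (sym (suc-injective v+1≡j+1)) value atX
    where
    shuffle : ∀ j r → suc (j + j + r) ≡ suc (j + (r + j))
    shuffle = solve-∀
    value : N ≡ suc i
    value = trans total (cong suc (trans (shuffle j r) (sym i≡)))

  involution-σ : Involution N σ
  involution-σ = involution size-σ inRange-σ involutive-σ

  -- A 132 pattern would have to lie in the top block, in the middle block, or
  -- in the bottom block followed by j+1; the first and last contradict φ, the middle one τ.
  avoids-σ : ¬ Has132 σ
  avoids-σ p with Has132-++⁻ P p
  ... | inj₁ q = φ-avoids (Has132-++ˡ H2 (Has132-unshift (suc r) H1 q))
  ... | inj₂ (inj₂ (_ , y , _ , _ , my , here refl , _ , N<y)) =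
    <-irrefl refl (<-≤-trans N<y (proj₂ (Involution-∈ involution-σ ([ ∈-++⁺ˡ , ∈-++⁺ʳ P ]′ my))))
  ... | inj₂ (inj₂ (_ , _ , _ , ma , _ , there mz , a<z , _)) =
    <-asym a<z (≤-trans (s≤s (after-max-low mz)) (P-high ma))
  ... | inj₂ (inj₁ q)
    with Has132-block⁻ Mm (H2 ++ suc j ∷ []) (λ ma mz → ≤-trans (s≤s (tail-low mz)) (proj₁ (Mm-range ma)))
           (Has132-max∷⁻ N _ (λ mz → ≤-trans (s≤s (after-max-low mz)) N-high) q)
  ... | inj₁ q′ = τ-avoids (Has132-unshift (suc j) τ q′)
  ... | inj₂ q′ = φ-avoids (Has132-++ʳ H1 (Has132-∷max⁻ H2 bottom-low q′))

Unique-++⁻ˡ : ∀ (xs : List ℕ) {ys} → Unique (xs ++ ys) → Unique xs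
Unique-++⁻ˡ []       _        = []
Unique-++⁻ˡ (x ∷ xs) (x∉ ∷ u) = All.tabulate (All.lookup x∉ ∘ ∈-++⁺ˡ) ∷ Unique-++⁻ˡ xs u

Unique-++⁻ʳ : ∀ (xs : List ℕ) {ys} → Unique (xs ++ ys) → Unique ys
Unique-++⁻ʳ []       u       = u
Unique-++⁻ʳ (x ∷ xs) (_ ∷ u) = Unique-++⁻ʳ xs u

Unique-++-disjoint : ∀ (xs : List ℕ) {ys v} → Unique (xs ++ ys) → v ∈ xs → v ∈ ys → ⊥
Unique-++-disjoint (x ∷ xs) (x∉ ∷ u) (here refl) m₂ = All.lookup x∉ (∈-++⁺ʳ xs m₂) refl
Unique-++-disjoint (x ∷ xs) (_ ∷ u)  (there m₁) m₂  = Unique-++-disjoint xs u m₁ m₂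

-- Facts about a 132-avoiding involution σ = P , n+1 , Mi , B , p+1 of [n+1] whose
-- middle entries exceed p+1 and whose bottom entries are at most p: its pieces
-- form an assembly with j = p and r = |Mi|.
module Decompose (n p : ℕ) (P Mi B : List ℕ)
  (g     : Involution (suc n) (fiveBlocks P (suc n) Mi B (suc p)))
  (no132 : ¬ Has132 (fiveBlocks P (suc n) Mi B (suc p)))
  (|P|   : length P ≡ p)
  (mid   : ∀ {v} → v ∈ Mi → suc p < v)
  (small : ∀ {v} → v ∈ B → v ≤ p) where

  r : ℕ
  r = length Mi

  open FiveBlocks P (suc n) Mi B (suc p) |P| refl refl

  S : List ℕ
  S = Mi ++ (B ++ suc p ∷ [])

  unique-σ : Unique σ
  unique-σ = Involution-unique g

  -- Everything before the maximum exceeds everything after it (else P, n+1, S give a 132).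
  P-above-S : ∀ {a z} → a ∈ P → z ∈ S → z < a
  P-above-S {a} {z} ma mz with <-cmp a z
  ... | tri> _ _ z<a = z<a
  ... | tri≈ _ refl _ = ⊥-elim (Unique-++-disjoint P unique-σ ma (there mz))
  ... | tri< a<z _ _ = ⊥-elim (no132 (a , suc n , z , Sublist.++⁺ (from∈ ma) (refl ∷ from∈ mz) , a<z , z<N))
    where
    z<N : z < suc n
    z<N = ≤∧≢⇒< (proj₂ (Involution-∈ g (∈-++⁺ʳ P (there mz))))
                (λ { refl → proj₂ (Unique-remove P S unique-σ) (∈-++⁺ʳ P mz) })

  P-above-p+1 : ∀ {a} → a ∈ P → suc p < a
  P-above-p+1 ma = P-above-S ma (∈-++⁺ʳ Mi (∈-++⁺ʳ B (here refl)))

  p≤n : p ≤ n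
  p≤n = ≤-pred (subst (p <_) (size g) (At-bound atX))

  B↭positions : B ↭ positions p
  B↭positions = Unique-same-members-↭ unique-B (Unique.map⁺ suc-injective (Unique.upTo⁺ p)) B⊆ ⊆B
    where
    unique-B : Unique B
    unique-B = Unique-++⁻ˡ B (Unique-++⁻ʳ Mi (Unique-++⁻ʳ (P ++ suc n ∷ []) (subst Unique (sym (++-assoc P _ S)) unique-σ)))
    B⊆ : ∀ {v} → v ∈ B → v ∈ positions p
    B⊆ {v} m with v | proj₁ (Involution-∈ g (∈-++⁺ʳ P (there (∈-++⁺ʳ Mi (∈-++⁺ˡ m))))) | small m
    ... | suc v′ | _ | v≤p = ∈-positions⁺ v≤p
    ⊆B : ∀ {v} → v ∈ positions p → v ∈ B
    ⊆B m with i , refl , i<p ← ∈-positions⁻ m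
      with ∈-++⁻ P (Involution-onto g (s≤s z≤n) (s≤s (≤-trans (<⇒≤ i<p) p≤n)))
    ... | inj₁ mP = ⊥-elim (<-asym (P-above-p+1 mP) (s≤s i<p))
    ... | inj₂ (here e) = ⊥-elim (<-irrefl (suc-injective e) (<-≤-trans i<p p≤n))
    ... | inj₂ (there mS) with ∈-++⁻ Mi mS
    ... | inj₁ mM = ⊥-elim (<-asym (mid mM) (s≤s i<p))
    ... | inj₂ mBy with ∈-++⁻ B mBy
    ... | inj₁ mB = mB
    ... | inj₂ (here e) = ⊥-elim (<-irrefl (suc-injective e) i<p)

  |B| : length B ≡ p
  |B| = trans (Perm.↭-length B↭positions) (trans (length-map suc (upTo p)) (length-upTo p))

  size-count : suc n ≡ suc (suc (p + p + r))
  size-count = begin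
    suc n                                        ≡⟨ sym (size g) ⟩
    length σ                                     ≡⟨ length-++ P ⟩
    length P + suc (length S)                    ≡⟨ cong (λ t → length P + suc t) (length-++ Mi) ⟩
    length P + suc (r + length (B ++ suc p ∷ [])) ≡⟨ cong (λ t → length P + suc (r + t)) (length-++ B) ⟩
    length P + suc (r + (length B + 1))          ≡⟨ cong₂ (λ x y → x + suc (r + (y + 1))) |P| |B| ⟩
    p + suc (r + (p + 1))                        ≡⟨ count p r ⟩
    suc (suc (p + p + r))                        ∎
    where
    open ≡-Reasoning
    count : ∀ p r → p + suc (r + (p + 1)) ≡ suc (suc (p + p + r))
    count = solve-∀

  -- An entry a of P sends its position i < p to the bottom block (the only block
  -- holding values ≤ p), which lies at positions ≥ p + r + 1.  Hence a ≥ p + r + 2.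
  P-high : ∀ {a} → a ∈ P → suc (suc (p + r)) ≤ a
  P-high {a} ma with i , h ← ∈⇒At ma with a | h | proj₁ (inRange g (atP h))
  ... | suc a′ | h′ | _ with entry (involutive g (atP h′))
  ... | inP h₂     = ⊥-elim (<-asym (P-above-p+1 (At⇒∈ h₂)) (s≤s (subst (i <_) |P| (At-bound h′))))
  ... | isX _ ev   = ⊥-elim (<-irrefl (suc-injective ev) (<-≤-trans (subst (i <_) |P| (At-bound h′)) p≤n))
  ... | inM _ h₂   = ⊥-elim (<-asym (mid (At⇒∈ h₂)) (s≤s (subst (i <_) |P| (At-bound h′))))
  ... | inB {i′} e _ = s≤s (subst (suc (p + r) ≤_) (sym e) (s≤s (+-monoʳ-≤ p (m≤m+n r i′))))
  ... | isY _ ev   = ⊥-elim (<-irrefl (suc-injective ev) (subst (i <_) |P| (At-bound h′)))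

  P-low : ∀ {a} → a ∈ P → a ≤ n
  P-low ma = ≤-pred (≤∧≢⇒< (proj₂ (Involution-∈ g (∈-++⁺ˡ ma)))
                           (λ { refl → proj₂ (Unique-remove P S unique-σ) (∈-++⁺ˡ ma) }))

  -- A middle entry u sits at position p + 1 + i′ and is matched within the middle
  -- block, so u ≤ p + r + 1.
  Mi-low : ∀ {u} → u ∈ Mi → u ≤ suc (p + r)
  Mi-low {u} mu with i′ , h ← ∈⇒At mu with u | h | proj₁ (inRange g (atM h))
  ... | suc u′ | h′ | _ with entry (involutive g (atM h′))
  ... | inP h₂ = ⊥-elim (<-irrefl refl (<-≤-trans (s≤s (s≤s (+-monoʳ-< p (At-bound h′)))) (P-high (At⇒∈ h₂))))
  ... | isX _ ev = ⊥-elim (<-irrefl refl (<-≤-trans (+-monoʳ-< p (At-bound h′))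
                    (≤-trans (+-monoˡ-≤ r (m≤n+m p p)) (≤-reflexive (sym (suc-injective (suc-injective (trans ev size-count))))))))
  ... | inM {i″} e h₂ = subst (λ t → suc t ≤ suc (p + r)) (sym e) (s≤s (+-monoʳ-< p (At-bound h₂)))
  ... | inB _ h₂ = ⊥-elim (≤⇒≯ (small (At⇒∈ h₂)) (s≤s (m≤n⇒m≤1+n (m≤m+n p i′))))
  ... | isY _ ev = ⊥-elim (<-irrefl (sym (suc-injective ev)) (s≤s (m≤m+n p i′)))

  H1 τ : List ℕ
  H1 = map (_∸ suc r) P
  τ  = map (_∸ suc p) Mi

  unshift : ∀ c xs → (∀ {v} → v ∈ xs → c ≤ v) → map (_+ c) (map (_∸ c) xs) ≡ xs
  unshift c []       _  = refl
  unshift c (x ∷ xs) ge = cong₂ _∷_ (m∸n+n≡m (ge (here refl))) (unshift c xs (ge ∘ there))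

  P≡ : map (_+ suc r) H1 ≡ P
  P≡ = unshift (suc r) P (λ m → ≤-trans (s≤s (m≤n⇒m≤1+n (m≤n+m r p))) (P-high m))

  Mi≡ : map (_+ suc p) τ ≡ Mi
  Mi≡ = unshift (suc p) Mi (<⇒≤ ∘ mid)

  σ≡ : assemble (suc n) p r H1 τ B ≡ σ
  σ≡ = cong₂ (λ x y → x ++ suc n ∷ (y ++ (B ++ suc p ∷ []))) P≡ Mi≡

  |H1| : length H1 ≡ p
  |H1| = trans (length-map (_∸ suc r) P) |P|

  |τ| : length τ ≡ r
  |τ| = length-map (_∸ suc p) Mi

  H1-range : ∀ {w} → w ∈ H1 → suc p ≤ w × w ≤ p + p
  H1-range {w} m = lo , hi
    where
    mP : (w + suc r) ∈ P
    mP = subst ((w + suc r) ∈_) P≡ (∈-map⁺ (_+ suc r) m)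
    lo : suc p ≤ w
    lo = +-cancelʳ-≤ (suc r) (suc p) w (subst (_≤ w + suc r) (cong suc (sym (+-suc p r))) (P-high mP))
    hi : w ≤ p + p
    hi = +-cancelʳ-≤ (suc r) w (p + p)
           (subst (w + suc r ≤_) (trans (suc-injective size-count) (sym (+-suc (p + p) r))) (P-low mP))

  τ-range : ∀ {w} → w ∈ τ → 1 ≤ w × w ≤ r
  τ-range {w} m = lo , hi
    where
    mM : (w + suc p) ∈ Mi
    mM = subst ((w + suc p) ∈_) Mi≡ (∈-map⁺ (_+ suc p) m)
    lo : 1 ≤ w
    lo = +-cancelʳ-< (suc p) 0 w (mid mM)
    hi : w ≤ r
    hi = +-cancelʳ-≤ (suc p) w r (subst (w + suc p ≤_) (trans (cong suc (+-comm p r)) (sym (+-suc r p))) (Mi-low mM))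

  At-τ⇒Mi : ∀ {i w} → At τ i w → At Mi i (w + suc p)
  At-τ⇒Mi {i} {w} h = subst (λ xs → At xs i (w + suc p)) Mi≡ (At-map (_+ suc p) h)

  At-Mi⇒τ : ∀ {i w} → At Mi i (w + suc p) → At τ i w
  At-Mi⇒τ {i} {w} h with w′ , h′ , e ← At-map⁻ (_+ suc p) (subst (λ xs → At xs i (w + suc p)) (sym Mi≡) h) =
    subst (At τ _) (sym (+-cancelʳ-≡ (suc p) w w′ e)) h′

  At-H1⇒P : ∀ {i w} → At H1 i w → At P i (w + suc r)
  At-H1⇒P {i} {w} h = subst (λ xs → At xs i (w + suc r)) P≡ (At-map (_+ suc r) h)

  At-P⇒H1 : ∀ {i w} → At P i (w + suc r) → At H1 i w
  At-P⇒H1 {i} {w} h with w′ , h′ , e ← At-map⁻ (_+ suc r) (subst (λ xs → At xs i (w + suc r)) (sym P≡) h) =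
    subst (At H1 _) (sym (+-cancelʳ-≡ (suc r) w w′ e)) h′

  -- τ is an involution: the middle block is matched with itself.
  involutive-τ : Involutive τ
  involutive-τ {i} {v} h = At-Mi⇒τ (subst (At Mi v) value (atM⁻ v<r (subst (λ k → At σ k (suc (suc (p + i)))) position matched)))
    where
    matched : At σ (v + suc p) (suc (suc (p + i)))
    matched = involutive g (atM (At-τ⇒Mi h))
    v<r : v < r
    v<r = proj₂ (τ-range (At⇒∈ h))
    position : v + suc p ≡ suc (p + v)
    position = trans (+-suc v p) (cong suc (+-comm v p))
    shuffle : ∀ p i → suc (suc (p + i)) ≡ suc i + suc p
    shuffle = solve-∀
    value : suc (suc (p + i)) ≡ suc i + suc p
    value = shuffle p i

  involution-τ : Involution r τ
  involution-τ = involution |τ| (τ-range ∘ At⇒∈) involutive-τ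

  fixedPointFree-τ : FixedPointFree σ → FixedPointFree τ
  fixedPointFree-τ fp {i} h = fp (subst (At σ _) value (atM (At-τ⇒Mi h)))
    where
    shuffle : ∀ p i → suc i + suc p ≡ suc (suc (p + i))
    shuffle = solve-∀
    value : suc i + suc p ≡ suc (suc (p + i))
    value = shuffle p i

  -- φ = H1 ++ B is an involution: the top block P is matched with the bottom block B.
  φ : List ℕ
  φ = H1 ++ B

  φ-range : InRange (p + p) φ
  φ-range h with At-++⁻ H1 h
  ... | inj₁ h₁ = let lo , hi = H1-range (At⇒∈ h₁) in ≤-trans (s≤s z≤n) lo , hi
  ... | inj₂ (_ , _ , h₂) = proj₁ (inRange g (atB h₂)) , ≤-trans (small (At⇒∈ h₂)) (m≤m+n p p)

  involutive-φ : Involutive φ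
  involutive-φ {i} {v} h with At-++⁻ H1 h
  ... | inj₁ h₁ = subst (λ k → At φ k (suc i)) position (At-++ʳ H1 (atB⁻ t<p (subst (λ k → At σ k (suc i)) position′ matched)))
    where
    p≤v : p ≤ v
    p≤v = ≤-pred (proj₁ (H1-range (At⇒∈ h₁)))
    t : ℕ
    t = v ∸ p
    v≡ : v ≡ p + t
    v≡ = sym (m+[n∸m]≡n p≤v)
    t<p : t < length B
    t<p = subst (t <_) (sym |B|) (+-cancelˡ-< p t p (subst (_< p + p) v≡ (proj₂ (H1-range (At⇒∈ h₁)))))
    matched : At σ (v + suc r) (suc i)
    matched = involutive g (atP (At-H1⇒P h₁))
    shuffle : ∀ p t r → p + t + suc r ≡ suc (p + (r + t))
    shuffle = solve-∀
    position′ : v + suc r ≡ suc (p + (r + t))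
    position′ = trans (cong (_+ suc r) v≡) (shuffle p t r)
    position : length H1 + t ≡ v
    position = trans (cong (_+ t) |H1|) (sym v≡)
  ... | inj₂ (t , i≡ , h₂) = At-++ˡ (At-P⇒H1 (subst (At P v) value (atP⁻ v<p matched)))
    where
    matched : At σ v (suc (suc (p + (r + t))))
    matched = involutive g (atB h₂)
    v<p : v < p
    v<p = small (At⇒∈ h₂)
    shuffle : ∀ p t r → suc (suc (p + (r + t))) ≡ suc (p + t) + suc r
    shuffle = solve-∀
    value : suc (suc (p + (r + t))) ≡ suc i + suc r
    value = trans (shuffle p t r) (cong (λ k → suc k + suc r) (sym (trans i≡ (cong (_+ t) |H1|))))

  involution-φ : Involution (p + p) φ
  involution-φ = involution (trans (length-++ H1) (cong₂ _+_ |H1| |B|)) φ-range involutive-φ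

  fixedPointFree-φ : FixedPointFree φ
  fixedPointFree-φ {i} h with At-++⁻ H1 h
  ... | inj₁ h₁ = <-irrefl refl (<-≤-trans (subst (i <_) |H1| (At-bound h₁)) (≤-pred (proj₁ (H1-range (At⇒∈ h₁)))))
  ... | inj₂ (t , i≡ , h₂) =
    <-irrefl refl (<-≤-trans (s≤s (subst (_≤ i) |H1| (subst (length H1 ≤_) (sym i≡) (m≤m+n _ t)))) (small (At⇒∈ h₂)))

  avoids-τ : ¬ Has132 τ
  avoids-τ q = no132 (Has132-++ʳ P (Has132-∷ (suc n) (Has132-++ˡ _ (subst Has132 Mi≡ (Has132-shift (suc p) q)))))

  avoids-φ : ¬ Has132 φ
  avoids-φ q with Has132-block⁻ H1 B (λ ma mz → ≤-trans (s≤s (small mz)) (proj₁ (H1-range ma))) q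
  ... | inj₁ q₁ = no132 (Has132-++ˡ _ (subst Has132 P≡ (Has132-shift (suc r) q₁)))
  ... | inj₂ q₂ = no132 (Has132-++ʳ P (Has132-∷ (suc n) (Has132-++ʳ Mi (Has132-++ˡ _ q₂))))

  assembly : Assembly (suc n) p r H1 τ B
  assembly = record
    { top-size    = |H1|
    ; bottom-size = |B|
    ; total       = size-count
    ; τ-inv       = involution-τ
    ; τ-avoids    = avoids-τ
    ; φ-inv       = involution-φ
    ; φ-fpf       = fixedPointFree-φ
    ; φ-avoids    = avoids-φ
    ; top-high    = proj₁ ∘ H1-range
    ; bottom-low  = small
    }

data Shape (N : ℕ) (σ : List ℕ) : Set where
  maxFixed  : ∀ {n τ} → N ≡ suc n → σ ≡ τ ++ N ∷ [] → Involution n τ → ¬ Has132 τ → Shape N σ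
  assembled : ∀ {j r H1 τ H2} → σ ≡ assemble N j r H1 τ H2 → Assembly N j r H1 τ H2 →
              (FixedPointFree σ → FixedPointFree τ) → Shape N σ

split-high-low : ∀ (high low : ℕ → Set) (L : List ℕ) →
  (∀ {v} → v ∈ L → high v ⊎ low v) →
  (∀ {u w} → (u ∷ w ∷ []) ⊆ L → low u → high w → ⊥) →
  (∀ {v} → high v → low v → ⊥) →
  ∃₂ λ Hs Ls → L ≡ Hs ++ Ls × (∀ {v} → v ∈ Hs → high v) × (∀ {v} → v ∈ Ls → low v)
split-high-low high low []      _     _        _    = [] , [] , refl , (λ ()) , (λ ())
split-high-low high low (x ∷ L) kinds no-inversion disjoint with kinds (here refl)
... | inj₁ hx with Hs , Ls , refl , highs , lows ← split-high-low high low L (kinds ∘ there) (no-inversion ∘ (x ∷ʳ_)) disjoint =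
  x ∷ Hs , Ls , refl , (λ { (here refl) → hx ; (there m) → highs m }) , lows
... | inj₂ lx = [] , x ∷ L , refl , (λ ()) , all-low
  where
  all-low : ∀ {v} → v ∈ x ∷ L → low v
  all-low (here refl) = lx
  all-low (there m) with kinds (there m)
  ... | inj₂ lv = lv
  ... | inj₁ hv = ⊥-elim (no-inversion (refl ∷ from∈ m) lx hv)

-- In σ = P , n+1 , S0 , p+1, the entries of S0 are those above p+1 followed by
-- those at most p: a low entry u before a high entry w would make u w (p+1) a 132.
split-middle : ∀ n p P S0 →
  Involution (suc n) (P ++ suc n ∷ (S0 ++ suc p ∷ [])) → ¬ Has132 (P ++ suc n ∷ (S0 ++ suc p ∷ [])) →
  ∃₂ λ Mi B → S0 ≡ Mi ++ B × (∀ {v} → v ∈ Mi → suc p < v) × (∀ {v} → v ∈ B → v ≤ p)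
split-middle n p P S0 g no132 = split-high-low (suc p <_) (_≤ p) S0 kind no-inversion disjoint
  where
  p+1∉S0 : suc p ∉ S0
  p+1∉S0 m with _ ∷ u ← Unique-++⁻ʳ P (Involution-unique g) = Unique-++-disjoint S0 u m (here refl)
  kind : ∀ {v} → v ∈ S0 → suc p < v ⊎ v ≤ p
  kind {v} m with <-cmp (suc p) v
  ... | tri< p+1<v _ _ = inj₁ p+1<v
  ... | tri≈ _ refl _ = ⊥-elim (p+1∉S0 m)
  ... | tri> _ _ v<p+1 = inj₂ (≤-pred v<p+1)
  no-inversion : ∀ {u w} → (u ∷ w ∷ []) ⊆ S0 → u ≤ p → suc p < w → ⊥
  no-inversion s u≤p p+1<w =
    no132 (_ , _ , _ , Sublist.++⁺ˡ P (suc n ∷ʳ Sublist.++⁺ s (refl ∷ [])) , s≤s u≤p , p+1<w)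
  disjoint : ∀ {v} → suc p < v → v ≤ p → ⊥
  disjoint p+1<v v≤p = <-irrefl refl (<-≤-trans p+1<v (m≤n⇒m≤1+n v≤p))

assembled-shape : ∀ n p P S0 → length P ≡ p →
  Involution (suc n) (P ++ suc n ∷ (S0 ++ suc p ∷ [])) → ¬ Has132 (P ++ suc n ∷ (S0 ++ suc p ∷ [])) →
  Shape (suc n) (P ++ suc n ∷ (S0 ++ suc p ∷ []))
assembled-shape n p P S0 |P| g no132 with split-middle n p P S0 g no132
... | Mi , B , refl , mid , small =
  subst (Shape (suc n)) (sym reassociate)
    (assembled (sym D.σ≡) D.assembly D.fixedPointFree-τ)
  where
  reassociate : P ++ suc n ∷ ((Mi ++ B) ++ suc p ∷ []) ≡ fiveBlocks P (suc n) Mi B (suc p)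
  reassociate = cong (λ t → P ++ suc n ∷ t) (++-assoc Mi B (suc p ∷ []))
  module D = Decompose n p P Mi B (subst (Involution (suc n)) reassociate g)
                       (no132 ∘ subst Has132 (sym reassociate)) |P| mid small

-- Every 132-avoiding involution of [n+1] has one of the two shapes, according to
-- whether its last entry p+1 equals n+1.  The maximum n+1 sits at position p.
decompose : ∀ n σ → Involution (suc n) σ → ¬ Has132 σ → Shape (suc n) σ
decompose n σ g no132 with At-exists σ n (subst (n <_) (sym (size g)) ≤-refl)
... | w , final with w | final | proj₁ (inRange g final)
... | suc p | final′ | _ with At-split (involutive g final′)
... | P , S , refl , |P| with initLast S
... | [] = maxFixed refl refl (Involution-unsnoc g) (no132 ∘ Has132-++ˡ _)
... | S0 ∷ʳ′ y with refl ← At-functional final′ (subst (λ xs → At xs n y) (++-assoc P (suc n ∷ S0) (y ∷ []))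
                      (At-last n (P ++ suc n ∷ S0) y (trans (cong length (++-assoc P (suc n ∷ S0) (y ∷ []))) (size g))))
  = assembled-shape n p P S0 |P| g no132

-- The ascent statistics of an assembly, in terms of its pieces.  Only the value
-- ranges of the pieces matter: H1 ≤ 2j, H2 ≤ j, τ within 1 … r.
module AssemblyStatistics (N j r : ℕ) (H1 τ H2 : List ℕ)
  (total : N ≡ suc (suc (j + j + r)))
  (H1-low : ∀ {v} → v ∈ H1 → v ≤ j + j)
  (H2-low : ∀ {v} → v ∈ H2 → v ≤ j)
  (τ-range : ∀ {v} → v ∈ τ → 1 ≤ v × v ≤ r) where

  P Mm X R : List ℕ
  P  = map (_+ suc r) H1
  Mm = map (_+ suc j) τ
  X  = H2 ++ suc j ∷ []
  R  = Mm ++ X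

  Mm-range : ∀ {v} → v ∈ Mm → suc (suc j) ≤ v × v ≤ r + suc j
  Mm-range m with w , mw , refl ← ∈-map⁻ (_+ suc j) m =
    +-monoˡ-≤ (suc j) (proj₁ (τ-range mw)) , +-monoˡ-≤ (suc j) (proj₂ (τ-range mw))

  X-low : ∀ {v} → v ∈ X → v ≤ suc j
  X-low m with ∈-++⁻ H2 m
  ... | inj₁ m′         = m≤n⇒m≤1+n (H2-low m′)
  ... | inj₂ (here refl) = ≤-refl

  R-below-N : ∀ {v} → v ∈ R → v < N
  R-below-N m with ∈-++⁻ Mm m
  ... | inj₁ m′ = subst (_ <_) (sym total) (s≤s (≤-trans (proj₂ (Mm-range m′)) (bound j r)))
    where
    bound : ∀ j r → r + suc j ≤ suc (j + j + r)
    bound j r = subst (r + suc j ≤_) (count j r) (m≤m+n (r + suc j) j)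
      where
      count : ∀ j r → r + suc j + j ≡ suc (j + j + r)
      count = solve-∀
  ... | inj₂ m′ = subst (_ <_) (sym total) (s≤s (≤-trans (X-low m′) (s≤s (≤-trans (m≤m+n j j) (m≤m+n (j + j) r)))))

  P-below-N : ∀ {v} → v ∈ P → v < N
  P-below-N m with w , mw , refl ← ∈-map⁻ (_+ suc r) m =
    subst (_ <_) (sym total) (s≤s (subst (w + suc r ≤_) (+-suc (j + j) r) (+-monoˡ-≤ (suc r) (H1-low mw))))

  -- The last entry j+1 exceeds all of H2: one more ascent, at position |H2|.
  ascents-X : ascents X ≡ ascents H2 + nonEmpty H2
  ascents-X = ascents-snoc-max H2 (suc j) (s≤s ∘ H2-low)

  -- The middle block lies above X: no ascent at their junction.
  junction-Mm-X : junction Mm X ≡ 0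
  junction-Mm-X = junction-descent Mm X (λ mv mz → <-≤-trans (s≤s (X-low mz)) (proj₁ (Mm-range mv)))

  ascents-R : ascents R ≡ ascents τ + (ascents H2 + nonEmpty H2)
  ascents-R = begin
    ascents (Mm ++ X)                                   ≡⟨ ascents-++ Mm X ⟩
    ascents Mm + junction Mm X + ascents X              ≡⟨ cong₂ (λ a b → a + b + ascents X) (ascents-shift (suc j) τ) junction-Mm-X ⟩
    ascents τ + 0 + ascents X                           ≡⟨ cong₂ _+_ (+-identityʳ (ascents τ)) ascents-X ⟩
    ascents τ + (ascents H2 + nonEmpty H2)              ∎
    where open ≡-Reasoning

  comajor-R : comajor R ≡ comajor τ + (comajor H2 + nonEmpty H2 * length H2) + length τ * (ascents H2 + nonEmpty H2)
  comajor-R = begin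
    comajor (Mm ++ X)
      ≡⟨ comajor-++ Mm X ⟩
    comajor Mm + junction Mm X * length Mm + (comajor X + length Mm * ascents X)
      ≡⟨ cong₂ (λ a b → a + b * length Mm + (comajor X + length Mm * ascents X)) (comajor-shift (suc j) τ) junction-Mm-X ⟩
    comajor τ + 0 * length Mm + (comajor X + length Mm * ascents X)
      ≡⟨ cong₃ (length-map (_+ suc j) τ) (comajor-snoc-max H2 (suc j) (s≤s ∘ H2-low)) ascents-X ⟩
    comajor τ + 0 * length τ + ((comajor H2 + nonEmpty H2 * length H2) + length τ * (ascents H2 + nonEmpty H2))
      ≡⟨ regroup (comajor τ) (length τ) (comajor H2 + nonEmpty H2 * length H2) (ascents H2 + nonEmpty H2) ⟩
    comajor τ + (comajor H2 + nonEmpty H2 * length H2) + length τ * (ascents H2 + nonEmpty H2) ∎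
    where
    open ≡-Reasoning
    cong₃ : ∀ {l l′ c c′ a a′} → l ≡ l′ → c ≡ c′ → a ≡ a′ →
            comajor τ + 0 * l + (c + l * a) ≡ comajor τ + 0 * l′ + (c′ + l′ * a′)
    cong₃ refl refl refl = refl
    regroup : ∀ ct l c a → ct + 0 * l + (c + l * a) ≡ ct + c + l * a
    regroup = solve-∀

  junction-N-R : junction (N ∷ []) R ≡ 0
  junction-N-R = junction-descent (N ∷ []) R (λ { (here refl) mz → R-below-N mz })

  junction-P-N : ∀ {ys} → junction P (N ∷ ys) ≡ nonEmpty H1
  junction-P-N = trans (junction-ascent P P-below-N) (nonEmpty-map (_+ suc r) H1)
    where
    nonEmpty-map : ∀ (f : ℕ → ℕ) xs → nonEmpty (map f xs) ≡ nonEmpty xs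
    nonEmpty-map f []      = refl
    nonEmpty-map f (x ∷ xs) = refl

  ascents-assemble : ascents (assemble N j r H1 τ H2) ≡ ascents H1 + nonEmpty H1 + ascents R
  ascents-assemble = begin
    ascents (P ++ N ∷ R)                              ≡⟨ ascents-++ P (N ∷ R) ⟩
    ascents P + junction P (N ∷ R) + ascents (N ∷ R)  ≡⟨ cong₂ (λ a b → a + b + ascents (N ∷ R)) (ascents-shift (suc r) H1) junction-P-N ⟩
    ascents H1 + nonEmpty H1 + ascents (N ∷ R)        ≡⟨ cong (ascents H1 + nonEmpty H1 +_) (ascents-++ (N ∷ []) R) ⟩
    ascents H1 + nonEmpty H1 + (junction (N ∷ []) R + ascents R) ≡⟨ cong (λ t → ascents H1 + nonEmpty H1 + (t + ascents R)) junction-N-R ⟩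
    ascents H1 + nonEmpty H1 + ascents R              ∎
    where open ≡-Reasoning

  comajor-N∷R : comajor (N ∷ R) ≡ comajor R + ascents R
  comajor-N∷R = trans (comajor-++ (N ∷ []) R)
                  (trans (cong (λ t → 0 + t * 1 + (comajor R + 1 * ascents R)) junction-N-R)
                         (simplify (comajor R) (ascents R)))
    where
    simplify : ∀ c a → 0 + 0 * 1 + (c + 1 * a) ≡ c + a
    simplify = solve-∀

  comajor-assemble : comajor (assemble N j r H1 τ H2) ≡
    comajor H1 + nonEmpty H1 * length H1 + (comajor R + ascents R + length H1 * ascents R)
  comajor-assemble =
    trans (comajor-++ P (N ∷ R))
          (cong₅ (comajor-shift (suc r) H1) junction-P-N (length-map (_+ suc r) H1) comajor-N∷R
                 (trans (ascents-++ (N ∷ []) R) (cong (_+ ascents R) junction-N-R)))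
    where
    cong₅ : ∀ {a a′ b b′ l l′ c c′ d d′} → a ≡ a′ → b ≡ b′ → l ≡ l′ → c ≡ c′ → d ≡ d′ →
            a + b * l + (c + l * d) ≡ a′ + b′ * l′ + (c′ + l′ * d′)
    cong₅ refl refl refl refl refl = refl

take-length-++ : ∀ (xs ys : List ℕ) → take (length xs) (xs ++ ys) ≡ xs
take-length-++ []       ys = refl
take-length-++ (x ∷ xs) ys = cong (x ∷_) (take-length-++ xs ys)

drop-length-++ : ∀ (xs ys : List ℕ) → drop (length xs) (xs ++ ys) ≡ ys
drop-length-++ []       ys = refl
drop-length-++ (x ∷ xs) ys = drop-length-++ xs ys

take-beyond : ∀ (xs ys : List ℕ) k → take (length xs + k) (xs ++ ys) ≡ xs ++ take k ys
take-beyond []       ys k = refl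
take-beyond (x ∷ xs) ys k = cong (x ∷_) (take-beyond xs ys k)

drop-beyond : ∀ (xs ys : List ℕ) k → drop (length xs + k) (xs ++ ys) ≡ drop k ys
drop-beyond []       ys k = refl
drop-beyond (x ∷ xs) ys k = drop-beyond xs ys k

take-within : ∀ (xs ys : List ℕ) k → k ≤ length xs → take k (xs ++ ys) ≡ take k xs
take-within xs       ys zero    _       = refl
take-within (x ∷ xs) ys (suc k) (s≤s h) = cong (x ∷_) (take-within xs ys k h)

drop-within : ∀ (xs ys : List ℕ) k → k ≤ length xs → drop k (xs ++ ys) ≡ drop k xs ++ ys
drop-within xs       ys zero    _       = refl
drop-within (x ∷ xs) ys (suc k) (s≤s h) = drop-within xs ys k h

∈-take : ∀ {v} k (xs : List ℕ) → v ∈ take k xs → v ∈ xs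
∈-take k xs = lookup (Sublist.take-⊆ k xs)

∈-drop : ∀ {v} k (xs : List ℕ) → v ∈ drop k xs → v ∈ xs
∈-drop k xs = lookup (Sublist.drop-⊆ k xs)

record HalfSplit (j : ℕ) (φ : List ℕ) : Set where
  field
    first-high : ∀ {w} → w ∈ take j φ → j < w
    second-low : ∀ {w} → w ∈ drop j φ → w ≤ j
    balanced   : ascents (take j φ) ≡ ascents (drop j φ)

module HalfSplitStep {j j₂ m : ℕ} {H1 τ H2 : List ℕ}
  (d   : Assembly (suc (j + suc j)) j₂ (m + m) H1 τ H2)
  (j≡  : j ≡ j₂ + m)
  (τ-split : HalfSplit m τ)
  (φ-split : HalfSplit j₂ (H1 ++ H2)) where

  open Assembly d
  N r : ℕ
  N = suc (j + suc j)
  r = m + m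
  open AssemblyStatistics N j₂ r H1 τ H2 total (λ m → proj₂ (Involution-∈ φ-inv (∈-++⁺ˡ m))) bottom-low (Involution-∈ τ-inv)
  open HalfSplit

  σ : List ℕ
  σ = assemble N j₂ r H1 τ H2

  top-half bottom-half : List ℕ
  top-half    = map (_+ suc j₂) (take m τ)
  bottom-half = map (_+ suc j₂) (drop m τ)

  |P| : length P ≡ j₂
  |P| = trans (length-map (_+ suc r) H1) top-size

  m≤|Mm| : m ≤ length Mm
  m≤|Mm| = subst (m ≤_) (sym (trans (length-map (_+ suc j₂) τ) (size τ-inv))) (m≤m+n m m)

  suc-j≡ : suc j ≡ length P + suc m
  suc-j≡ = trans (cong suc j≡) (trans (sym (+-suc j₂ m)) (cong (_+ suc m) (sym |P|)))

  take-σ : take (suc j) σ ≡ P ++ N ∷ top-half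
  take-σ = begin
    take (suc j) σ                          ≡⟨ cong (λ t → take t σ) suc-j≡ ⟩
    take (length P + suc m) (P ++ N ∷ R)    ≡⟨ take-beyond P (N ∷ R) (suc m) ⟩
    P ++ N ∷ take m (Mm ++ X)               ≡⟨ cong (λ t → P ++ N ∷ t) (take-within Mm X m m≤|Mm|) ⟩
    P ++ N ∷ take m Mm                      ≡⟨ cong (λ t → P ++ N ∷ t) (take-map m τ) ⟩
    P ++ N ∷ top-half                       ∎
    where open ≡-Reasoning

  drop-σ : drop (suc j) σ ≡ bottom-half ++ X
  drop-σ = begin
    drop (suc j) σ                          ≡⟨ cong (λ t → drop t σ) suc-j≡ ⟩
    drop (length P + suc m) (P ++ N ∷ R)    ≡⟨ drop-beyond P (N ∷ R) (suc m) ⟩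
    drop m (Mm ++ X)                        ≡⟨ drop-within Mm X m m≤|Mm| ⟩
    drop m Mm ++ X                          ≡⟨ cong (_++ X) (drop-map m τ) ⟩
    bottom-half ++ X                        ∎
    where open ≡-Reasoning

  suc-j≡′ : suc j ≡ m + suc j₂
  suc-j≡′ = trans (cong suc (trans j≡ (+-comm j₂ m))) (sym (+-suc m j₂))

  top-high-σ : ∀ {w} → w ∈ take (suc j) σ → suc j < w
  top-high-σ {w} mw with ∈-++⁻ P (subst (w ∈_) take-σ mw)
  ... | inj₁ mP with v , mv , refl ← ∈-map⁻ (_+ suc r) mP =
    subst (_< v + suc r) (sym (cong suc j≡))
      (subst (_≤ v + suc r) (cong suc (+-suc j₂ m)) (+-mono-≤ (top-high mv) (s≤s (m≤m+n m m))))
  top-high-σ mw | inj₂ (here refl) = s≤s (m≤n+m (suc j) j)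
  top-high-σ mw | inj₂ (there mT) with v , mv , refl ← ∈-map⁻ (_+ suc j₂) mT =
    subst (_< v + suc j₂) (sym suc-j≡′) (+-monoˡ-< (suc j₂) (first-high τ-split mv))

  bottom-low-σ : ∀ {w} → w ∈ drop (suc j) σ → w ≤ suc j
  bottom-low-σ {w} mw with ∈-++⁻ bottom-half (subst (w ∈_) drop-σ mw)
  ... | inj₁ mD with v , mv , refl ← ∈-map⁻ (_+ suc j₂) mD =
    subst (v + suc j₂ ≤_) (sym suc-j≡′) (+-monoˡ-≤ (suc j₂) (second-low τ-split mv))
  ... | inj₂ mX = ≤-trans (X-low mX) (s≤s (subst (j₂ ≤_) (sym j≡) (m≤m+n j₂ m)))

  balanced-φ : ascents H1 ≡ ascents H2
  balanced-φ = subst₂ (λ a b → ascents a ≡ ascents b)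
    (trans (cong (λ t → take t (H1 ++ H2)) (sym top-size)) (take-length-++ H1 H2))
    (trans (cong (λ t → drop t (H1 ++ H2)) (sym top-size)) (drop-length-++ H1 H2))
    (balanced φ-split)

  ascents-top : ascents (P ++ N ∷ top-half) ≡ ascents H1 + nonEmpty H1 + ascents (take m τ)
  ascents-top = begin
    ascents (P ++ N ∷ top-half)
      ≡⟨ ascents-++ P (N ∷ top-half) ⟩
    ascents P + junction P (N ∷ top-half) + ascents (N ∷ top-half)
      ≡⟨ cong₂ (λ a b → a + b + ascents (N ∷ top-half)) (ascents-shift (suc r) H1) junction-P-N ⟩
    ascents H1 + nonEmpty H1 + ascents (N ∷ top-half)
      ≡⟨ cong (ascents H1 + nonEmpty H1 +_) (ascents-++ (N ∷ []) top-half) ⟩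
    ascents H1 + nonEmpty H1 + (junction (N ∷ []) top-half + ascents top-half)
      ≡⟨ cong₂ (λ a b → ascents H1 + nonEmpty H1 + (a + b)) descent (ascents-shift (suc j₂) (take m τ)) ⟩
    ascents H1 + nonEmpty H1 + ascents (take m τ) ∎
    where
    open ≡-Reasoning
    descent : junction (N ∷ []) top-half ≡ 0
    descent = junction-descent (N ∷ []) top-half λ { (here refl) mz → R-below-N (∈-++⁺ˡ (inMm mz)) }
      where
      inMm : ∀ {w} → w ∈ top-half → w ∈ Mm
      inMm mw with v , mv , refl ← ∈-map⁻ (_+ suc j₂) mw = ∈-map⁺ (_+ suc j₂) (∈-take m τ mv)

  ascents-bottom : ascents (bottom-half ++ X) ≡ ascents (drop m τ) + (ascents H2 + nonEmpty H2)
  ascents-bottom = begin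
    ascents (bottom-half ++ X)                          ≡⟨ ascents-++ bottom-half X ⟩
    ascents bottom-half + junction bottom-half X + ascents X
      ≡⟨ cong₂ (λ a b → a + b + ascents X) (ascents-shift (suc j₂) (drop m τ)) descent ⟩
    ascents (drop m τ) + 0 + ascents X                 ≡⟨ cong₂ _+_ (+-identityʳ _) ascents-X ⟩
    ascents (drop m τ) + (ascents H2 + nonEmpty H2)    ∎
    where
    open ≡-Reasoning
    descent : junction bottom-half X ≡ 0
    descent = junction-descent bottom-half X (λ mv mz → <-≤-trans (s≤s (X-low mz)) (proj₁ (Mm-range (inMm mv))))
      where
      inMm : ∀ {w} → w ∈ bottom-half → w ∈ Mm
      inMm mw with v , mv , refl ← ∈-map⁻ (_+ suc j₂) mw = ∈-map⁺ (_+ suc j₂) (∈-drop m τ mv)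

  balanced-σ : ascents (take (suc j) σ) ≡ ascents (drop (suc j) σ)
  balanced-σ = begin
    ascents (take (suc j) σ)                               ≡⟨ cong ascents take-σ ⟩
    ascents (P ++ N ∷ top-half)                            ≡⟨ ascents-top ⟩
    ascents H1 + nonEmpty H1 + ascents (take m τ)          ≡⟨ cong₃ balanced-φ same-size (balanced τ-split) ⟩
    ascents H2 + nonEmpty H2 + ascents (drop m τ)          ≡⟨ +-comm _ (ascents (drop m τ)) ⟩
    ascents (drop m τ) + (ascents H2 + nonEmpty H2)        ≡⟨ sym ascents-bottom ⟩
    ascents (bottom-half ++ X)                             ≡⟨ cong ascents (sym drop-σ) ⟩
    ascents (drop (suc j) σ)                               ∎
    where
    open ≡-Reasoning
    cong₃ : ∀ {a a′ b b′ c c′} → a ≡ a′ → b ≡ b′ → c ≡ c′ → a + b + c ≡ a′ + b′ + c′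
    cong₃ refl refl refl = refl
    same-size : nonEmpty H1 ≡ nonEmpty H2
    same-size = nonEmpty-size H1 H2 (trans top-size (sym bottom-size))
      where
      nonEmpty-size : ∀ (a b : List ℕ) → length a ≡ length b → nonEmpty a ≡ nonEmpty b
      nonEmpty-size []      []      _ = refl
      nonEmpty-size (_ ∷ _) (_ ∷ _) _ = refl

  half-split-σ : HalfSplit (suc j) σ
  half-split-σ = record { first-high = top-high-σ ; second-low = bottom-low-σ ; balanced = balanced-σ }

halves : ∀ j j₂ r → j + suc j ≡ suc (j₂ + j₂ + r) → ∃ λ m → j ≡ j₂ + m × r ≡ m + m
halves j j₂ r e = m , j≡ , r≡
  where
  j₂≤j : j₂ ≤ j
  j₂≤j with j₂ ≤? j
  ... | yes h = h
  ... | no j₂≰j = ⊥-elim (<-irrefl refl (≤-trans lower (+-mono-≤ (<⇒≤ j<j₂) j<j₂)))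
    where
    j<j₂ : j < j₂
    j<j₂ = ≰⇒> j₂≰j
    lower : suc (j₂ + j₂) ≤ j + suc j
    lower = subst (suc (j₂ + j₂) ≤_) (sym e) (s≤s (m≤m+n (j₂ + j₂) r))
  m : ℕ
  m = j ∸ j₂
  j≡ : j ≡ j₂ + m
  j≡ = sym (m+[n∸m]≡n j₂≤j)
  count : ∀ j₂ m → j₂ + m + suc (j₂ + m) ≡ suc (j₂ + j₂ + (m + m))
  count = solve-∀
  r≡ : r ≡ m + m
  r≡ = sym (+-cancelˡ-≡ (j₂ + j₂) (m + m) r
         (suc-injective (trans (sym (count j₂ m)) (subst (λ t → t + suc t ≡ suc (j₂ + j₂ + r)) j≡ e))))

-- Every φ ∈ FI_{2j}(132) is half-split.  By strong induction on j: φ cannot fix its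
-- maximum, so it is an assembly whose pieces τ and H1 ++ H2 are smaller instances.
half-split : ∀ j φ → Involution (j + j) φ → FixedPointFree φ → ¬ Has132 φ → HalfSplit j φ
half-split = <-rec (λ j → ∀ φ → Involution (j + j) φ → FixedPointFree φ → ¬ Has132 φ → HalfSplit j φ) step
  where
  step : ∀ j → (∀ {j′} → j′ < j → ∀ φ → Involution (j′ + j′) φ → FixedPointFree φ → ¬ Has132 φ → HalfSplit j′ φ) →
         ∀ φ → Involution (j + j) φ → FixedPointFree φ → ¬ Has132 φ → HalfSplit j φ
  step zero    _  []  _ _  _     = record { first-high = λ () ; second-low = λ () ; balanced = refl }
  step (suc j) ih φ   g fp no132 with decompose (j + suc j) φ g no132
  ... | maxFixed {n} {τ} e refl _ _ =
    ⊥-elim (fp (subst (At φ n) e (At-last n τ _ (trans (size g) e))))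
  ... | assembled {j₂} {r} {H1} {τ} {H2} refl d fp-τ with m , j≡ , refl ← halves j j₂ r (suc-injective (Assembly.total d)) =
    HalfSplitStep.half-split-σ d j≡
      (ih (s≤s (subst (m ≤_) (sym j≡) (m≤n+m m j₂))) τ (Assembly.τ-inv d) (fp-τ fp) (Assembly.τ-avoids d))
      (ih (s≤s (subst (j₂ ≤_) (sym j≡) (m≤m+n j₂ m))) (H1 ++ H2) (Assembly.φ-inv d) (Assembly.φ-fpf d) (Assembly.φ-avoids d))

double≤⇒≤half : ∀ n k → k + k ≤ n → k ≤ ⌊ n /2⌋
double≤⇒≤half n             zero    _       = z≤n
double≤⇒≤half (suc zero)    (suc k) (s≤s h) with () ← subst (_≤ 0) (+-suc k k) h
double≤⇒≤half (suc (suc n)) (suc k) (s≤s h) = s≤s (double≤⇒≤half n k (≤-pred (subst (_≤ suc n) (+-suc k k) h)))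

≤half⇒double≤ : ∀ n k → k ≤ ⌊ n /2⌋ → k + k ≤ n
≤half⇒double≤ n             zero    _       = z≤n
≤half⇒double≤ (suc (suc n)) (suc k) (s≤s h) = s≤s (subst (_≤ suc n) (sym (+-suc k k)) (s≤s (≤half⇒double≤ n k h)))

kRange⁻ : ∀ {n k} → k ∈ kRange n → ∃ λ j → k ≡ suc (suc j) × k + k ≤ n
kRange⁻ {n} m with i , mi , refl ← ∈-map⁻ (λ j → j + 2) m =
  i , +-comm i 2 , ≤half⇒double≤ n (i + 2) (subst (_≤ ⌊ n /2⌋) (+-comm 2 i) (below (∈-upTo⁻ mi)))
  where
  below : ∀ {i h} → i < h ∸ 1 → suc (suc i) ≤ h
  below {h = suc h} i<h = s≤s i<h

kRange⁺ : ∀ n j → suc (suc j) + suc (suc j) ≤ n → suc (suc j) ∈ kRange n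
kRange⁺ n j h = subst (_∈ kRange n) (+-comm j 2) (∈-map⁺ (λ j → j + 2) (∈-upTo⁺ (below (double≤⇒≤half n _ h))))
  where
  below : ∀ {i h} → suc (suc i) ≤ h → i < h ∸ 1
  below {h = suc h} (s≤s i<h) = i<h

-- The explicit list of 132-avoiding involutions of [n], following the recurrence:
--   τ , n                      for τ ∈ I_{n-1}(132);
--   n , τ + 1 , 1              for τ ∈ I_{n-2}(132)                   (the case k = 1);
--   the assembly of φ, τ       for φ ∈ FI_{2(k-1)}(132), τ ∈ I_{n-2k}(132), 2 ≤ k ≤ n/2.
appendMax : ℕ → List ℕ → List ℕ
appendMax n τ = τ ++ n ∷ []

frame : ℕ → List ℕ → List ℕ
frame n τ = assemble n 0 (n ∸ 2) [] τ []

assembleHalves : ℕ → ℕ → List ℕ → List ℕ → List ℕ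
assembleHalves n k φ τ = assemble n (k ∸ 1) (n ∸ 2 * k) (take (k ∸ 1) φ) τ (drop (k ∸ 1) φ)

block : ℕ → ℕ → List (List ℕ)
block n k = concatMap (λ φ → map (assembleHalves n k φ) (I132 (n ∸ 2 * k))) (FI132 (2 * (k ∸ 1)))

enumeration : ℕ → List (List ℕ)
enumeration n = map (appendMax n) (I132 (n ∸ 1)) ++ (map (frame n) (I132 (n ∸ 2)) ++ concatMap (block n) (kRange n))

size-split : ∀ n j → suc j + suc j ≤ n → n ≡ suc (suc (j + j + (n ∸ 2 * suc j)))
size-split n j h = trans (sym (m+[n∸m]≡n h)) (trans (cong (λ t → suc j + suc j + (n ∸ t)) (sym twice)) (count j (n ∸ 2 * suc j)))
  where
  twice : 2 * suc j ≡ suc j + suc j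
  twice = cong (suc j +_) (+-identityʳ (suc j))
  count : ∀ j r → suc j + suc j + r ≡ suc (suc (j + j + r))
  count = solve-∀

FI132-size : ∀ j {φ} → φ ∈ FI132 (2 * j) → Involution (j + j) φ × FixedPointFree φ × ¬ Has132 φ
FI132-size j {φ} m with g , fp , no132 ← FI132⁻ (2 * j) m =
  subst (λ t → Involution t φ) (cong (j +_) (+-identityʳ j)) g , fp , no132

halves-size : ∀ j (φ : List ℕ) → length φ ≡ j + j → length (take j φ) ≡ j × length (drop j φ) ≡ j
halves-size j φ len =
  trans (length-take j φ) (trans (cong (j ℕ.⊓_) len) (m≤n⇒m⊓n≡m (m≤m+n j j))) ,
  trans (length-drop j φ) (trans (cong (_∸ j) len) (m+n∸m≡n j j))

-- The assembly data of a choice φ, τ: the half-split of φ supplies the value bounds.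
choice-assembly : ∀ n j {φ τ} → suc j + suc j ≤ n → φ ∈ FI132 (2 * j) → τ ∈ I132 (n ∸ 2 * suc j) →
  Assembly n j (n ∸ 2 * suc j) (take j φ) τ (drop j φ)
choice-assembly n j {φ} {τ} 2k≤n mφ mτ = record
  { top-size    = proj₁ sizes
  ; bottom-size = proj₂ sizes
  ; total       = size-split n j 2k≤n
  ; τ-inv       = proj₁ (I132⁻ (n ∸ 2 * suc j) mτ)
  ; τ-avoids    = proj₂ (I132⁻ (n ∸ 2 * suc j) mτ)
  ; φ-inv       = subst (Involution (j + j)) (sym (take++drop≡id j φ)) gφ
  ; φ-fpf       = subst FixedPointFree (sym (take++drop≡id j φ)) fpφ
  ; φ-avoids    = no132φ ∘ subst Has132 (take++drop≡id j φ)
  ; top-high    = HalfSplit.first-high split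
  ; bottom-low  = HalfSplit.second-low split
  }
  where
  gφ : Involution (j + j) φ
  gφ = proj₁ (FI132-size j mφ)
  fpφ : FixedPointFree φ
  fpφ = proj₁ (proj₂ (FI132-size j mφ))
  no132φ : ¬ Has132 φ
  no132φ = proj₂ (proj₂ (FI132-size j mφ))
  sizes : length (take j φ) ≡ j × length (drop j φ) ≡ j
  sizes = halves-size j φ (size gφ)
  split : HalfSplit j φ
  split = half-split j φ gφ fpφ no132φ

assembly-member : ∀ {N j r H1 τ H2} → Assembly N j r H1 τ H2 → assemble N j r H1 τ H2 ∈ I132 N
assembly-member {N} d = I132⁺ N (AssemblySound.involution-σ d) (AssemblySound.avoids-σ d)

[]∈FI132 : [] ∈ FI132 0
[]∈FI132 = FI132⁺ 0 Involution-[] (λ ()) ¬Has132-[]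

enumeration-sound : ∀ n₀ {σ} → σ ∈ enumeration (suc (suc n₀)) → σ ∈ I132 (suc (suc n₀))
enumeration-sound n₀ {σ} m with ∈-++⁻ (map (appendMax (suc (suc n₀))) (I132 (suc n₀))) m
... | inj₁ m₁ with τ , mτ , refl ← ∈-map⁻ (appendMax (suc (suc n₀))) m₁ with g , no132 ← I132⁻ (suc n₀) mτ =
  I132⁺ (suc (suc n₀)) (Involution-snoc g) (no132 ∘ Has132-∷max⁻ τ (proj₂ ∘ Involution-∈ g))
enumeration-sound n₀ {σ} m | inj₂ m₂ with ∈-++⁻ (map (frame (suc (suc n₀))) (I132 n₀)) m₂
... | inj₁ m₃ with τ , mτ , refl ← ∈-map⁻ (frame (suc (suc n₀))) m₃ =
  assembly-member (choice-assembly (suc (suc n₀)) 0 (s≤s (s≤s z≤n)) []∈FI132 mτ)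
... | inj₂ m₄ with k , mk , mσ ← find (∈-concatMap⁻ (block (suc (suc n₀))) {kRange (suc (suc n₀))} m₄)
  with j , refl , 2k≤n ← kRange⁻ {suc (suc n₀)} mk
  with φ , mφ , mσ′ ← find (∈-concatMap⁻ (λ φ → map (assembleHalves (suc (suc n₀)) k φ) (I132 (suc (suc n₀) ∸ 2 * k))) {FI132 (2 * suc j)} mσ)
  with τ , mτ , refl ← ∈-map⁻ (assembleHalves (suc (suc n₀)) k φ) mσ′ =
  assembly-member (choice-assembly (suc (suc n₀)) (suc j) 2k≤n mφ mτ)

length-0 : ∀ {xs : List ℕ} → length xs ≡ 0 → xs ≡ []
length-0 {[]} _ = refl

assembly-in-blocks : ∀ n₀ j {r H1 τ H2} → Assembly (suc (suc n₀)) (suc j) r H1 τ H2 →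
  assemble (suc (suc n₀)) (suc j) r H1 τ H2 ∈ concatMap (block (suc (suc n₀))) (kRange (suc (suc n₀)))
assembly-in-blocks n₀ j {r} {H1} {τ} {H2} d =
  ∈-concatMap⁺ (block n) {kRange n} (Any.map (λ { refl → in-block }) (kRange⁺ n j 2k≤n))
  where
  open Assembly d
  n k : ℕ
  n = suc (suc n₀)
  k = suc (suc j)
  twice : 2 * k ≡ k + k
  twice = cong (k +_) (+-identityʳ k)
  count : ∀ j r → suc (suc (suc j + suc j + r)) ≡ suc (suc j) + suc (suc j) + r
  count = solve-∀
  n≡ : n ≡ 2 * k + r
  n≡ = trans total (trans (count j r) (cong (_+ r) (sym twice)))
  2k≤n : k + k ≤ n
  2k≤n = subst (_≤ n) twice (subst (2 * k ≤_) (sym n≡) (m≤m+n (2 * k) r))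
  r≡ : n ∸ 2 * k ≡ r
  r≡ = trans (cong (_∸ 2 * k) n≡) (m+n∸m≡n (2 * k) r)
  φ : List ℕ
  φ = H1 ++ H2
  mφ : φ ∈ FI132 (2 * suc j)
  mφ = FI132⁺ (2 * suc j) (subst (λ t → Involution t φ) (cong (suc j +_) (sym (+-identityʳ (suc j)))) φ-inv) φ-fpf φ-avoids
  halves≡ : assembleHalves n k φ τ ≡ assemble n (suc j) r H1 τ H2
  halves≡ = cong₃ r≡
    (trans (cong (λ t → take t φ) (sym top-size)) (take-length-++ H1 H2))
    (trans (cong (λ t → drop t φ) (sym top-size)) (drop-length-++ H1 H2))
    where
    cong₃ : ∀ {a a′ b b′ c c′} → a ≡ a′ → b ≡ b′ → c ≡ c′ → assemble n (suc j) a b τ c ≡ assemble n (suc j) a′ b′ τ c′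
    cong₃ refl refl refl = refl
  in-block : assemble n (suc j) r H1 τ H2 ∈ block n k
  in-block = ∈-concatMap⁺ (λ φ → map (assembleHalves n k φ) (I132 (n ∸ 2 * k))) {FI132 (2 * suc j)}
    (Any.map (λ { refl → subst (_∈ map (assembleHalves n k φ) (I132 (n ∸ 2 * k))) halves≡
                             (∈-map⁺ (assembleHalves n k φ) (subst (λ t → τ ∈ I132 t) (sym r≡) (I132⁺ r τ-inv τ-avoids))) }) mφ)

enumeration-complete : ∀ n₀ {σ} → σ ∈ I132 (suc (suc n₀)) → σ ∈ enumeration (suc (suc n₀))
enumeration-complete n₀ {σ} m with g , no132 ← I132⁻ (suc (suc n₀)) m with decompose (suc n₀) σ g no132
... | maxFixed e refl gτ no132τ with refl ← suc-injective e =
  ∈-++⁺ˡ (∈-map⁺ (appendMax (suc (suc n₀))) (I132⁺ (suc n₀) gτ no132τ))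
... | assembled {zero} {r} {H1} {τ} {H2} refl d _
  with refl ← length-0 {H1} (Assembly.top-size d) | refl ← length-0 {H2} (Assembly.bottom-size d)
     | refl ← suc-injective (suc-injective (Assembly.total d)) =
  ∈-++⁺ʳ (map (appendMax n) (I132 (suc n₀)))
    (∈-++⁺ˡ (∈-map⁺ (frame n) (I132⁺ n₀ (Assembly.τ-inv d) (Assembly.τ-avoids d))))
  where
  n : ℕ
  n = suc (suc n₀)
... | assembled {suc j} refl d _ = ∈-++⁺ʳ (map (appendMax (suc (suc n₀))) (I132 (suc n₀)))
  (∈-++⁺ʳ (map (frame (suc (suc n₀))) (I132 n₀)) (assembly-in-blocks n₀ j d))

-- The listed permutations are distinct.  Within each part the pieces can be read
-- off; different parts (and different k) are told apart by the last entry,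
-- which is n, 1 and k respectively.

last-snoc : ∀ xs (y : ℕ) → last (xs ++ y ∷ []) ≡ just y
last-snoc []            y = refl
last-snoc (x ∷ [])      y = refl
last-snoc (x ∷ x′ ∷ xs) y = last-snoc (x′ ∷ xs) y

last-assemble : ∀ N j r H1 τ H2 → last (assemble N j r H1 τ H2) ≡ just (suc j)
last-assemble N j r H1 τ H2 = trans (cong last reassociate) (last-snoc (P ++ N ∷ (Mm ++ H2)) (suc j))
  where
  P Mm : List ℕ
  P  = map (_+ suc r) H1
  Mm = map (_+ suc j) τ
  reassociate : P ++ N ∷ (Mm ++ (H2 ++ suc j ∷ [])) ≡ (P ++ N ∷ (Mm ++ H2)) ++ suc j ∷ []
  reassociate = trans (cong (λ t → P ++ N ∷ t) (sym (++-assoc Mm H2 (suc j ∷ [])))) (sym (++-assoc P (N ∷ (Mm ++ H2)) (suc j ∷ [])))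

++-split : ∀ (a b c d : List ℕ) → length a ≡ length c → a ++ b ≡ c ++ d → a ≡ c × b ≡ d
++-split []      b []      d _   e = refl , e
++-split (x ∷ a) b (y ∷ c) d |a| e with refl , e′ ← ∷-injective e =
  let a≡c , b≡d = ++-split a b c d (suc-injective |a|) e′ in cong (x ∷_) a≡c , b≡d

assemble-injective : ∀ {N j r H1 τ H2 H1′ τ′ H2′} → length H1 ≡ length H1′ → length τ ≡ length τ′ →
  assemble N j r H1 τ H2 ≡ assemble N j r H1′ τ′ H2′ → H1 ≡ H1′ × τ ≡ τ′ × H2 ≡ H2′
assemble-injective {N} {j} {r} {H1} {τ} {H2} {H1′} {τ′} {H2′} |H1| |τ| e
  with P≡ , rest ← ++-split (map (_+ suc r) H1) _ (map (_+ suc r) H1′) _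
                     (trans (length-map _ H1) (trans |H1| (sym (length-map _ H1′)))) e
  with Mm≡ , X≡ ← ++-split (map (_+ suc j) τ) _ (map (_+ suc j) τ′) _
                     (trans (length-map _ τ) (trans |τ| (sym (length-map _ τ′)))) (∷-injectiveʳ rest) =
  map-injective (+-cancelʳ-≡ (suc r) _ _) P≡ , map-injective (+-cancelʳ-≡ (suc j) _ _) Mm≡ , ++-cancelʳ (suc j ∷ []) H2 H2′ X≡

Unique-block : ∀ n k → Unique (block n k)
Unique-block n k = Unique-concatMap (λ φ → map (assembleHalves n k φ) (I132 r)) (Unique-FI132 (2 * j))
  (λ _ → Unique.map⁺ τ-injective (Unique-I132 r)) φ-determined
  where
  j r : ℕ
  j = k ∸ 1
  r = n ∸ 2 * k
  τ-injective : ∀ {φ τ τ′} → assembleHalves n k φ τ ≡ assembleHalves n k φ τ′ → τ ≡ τ′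
  τ-injective {φ} e = map-injective (+-cancelʳ-≡ (suc j) _ _)
    (++-cancelʳ (drop j φ ++ suc j ∷ []) _ _ (∷-injectiveʳ (++-cancelˡ (map (_+ suc r) (take j φ)) _ _ e)))
  φ-determined : ∀ {φ φ′ σ} → φ ∈ FI132 (2 * j) → φ′ ∈ FI132 (2 * j) →
    σ ∈ map (assembleHalves n k φ) (I132 r) → σ ∈ map (assembleHalves n k φ′) (I132 r) → φ ≡ φ′
  φ-determined {φ} {φ′} mφ mφ′ mσ mσ′
    with τ , mτ , refl ← ∈-map⁻ (assembleHalves n k φ) mσ
    with τ′ , mτ′ , e ← ∈-map⁻ (assembleHalves n k φ′) mσ′
    with top≡ , _ , bottom≡ ← assemble-injective {n} {j} {r} {take j φ} {τ} {drop j φ} {take j φ′} {τ′} {drop j φ′}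
           (trans (proj₁ (halves-size j φ (size (proj₁ (FI132-size j mφ)))))
                  (sym (proj₁ (halves-size j φ′ (size (proj₁ (FI132-size j mφ′)))))))
           (trans (size (proj₁ (I132⁻ r mτ))) (sym (size (proj₁ (I132⁻ r mτ′))))) e =
    trans (sym (take++drop≡id j φ)) (trans (cong₂ _++_ top≡ bottom≡) (take++drop≡id j φ′))

Unique-enumeration : ∀ n₀ → Unique (enumeration (suc (suc n₀)))
Unique-enumeration n₀ = Unique.++⁺ unique-max (Unique.++⁺ unique-frame unique-blocks frame∩blocks) max∩rest
  where
  n : ℕ
  n = suc (suc n₀)
  unique-max : Unique (map (appendMax n) (I132 (suc n₀)))
  unique-max = Unique.map⁺ (λ {x} {y} e → ++-cancelʳ (n ∷ []) x y e) (Unique-I132 (suc n₀))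
  unique-frame : Unique (map (frame n) (I132 n₀))
  unique-frame = Unique.map⁺ (λ {x} {y} e → map-injective (+-cancelʳ-≡ 1 _ _) (++-cancelʳ (1 ∷ []) (map (_+ 1) x) (map (_+ 1) y) (∷-injectiveʳ e)))
                             (Unique-I132 n₀)
  last-in-block : ∀ k {σ} → σ ∈ block n k → last σ ≡ just (suc (k ∸ 1))
  last-in-block k mσ
    with φ , _ , mσ′ ← find (∈-concatMap⁻ (λ φ → map (assembleHalves n k φ) (I132 (n ∸ 2 * k))) {FI132 (2 * (k ∸ 1))} mσ)
    with τ , _ , refl ← ∈-map⁻ (assembleHalves n k φ) mσ′ = last-assemble n (k ∸ 1) (n ∸ 2 * k) (take (k ∸ 1) φ) τ (drop (k ∸ 1) φ)
  last-block : ∀ {σ} → σ ∈ concatMap (block n) (kRange n) → ∃ λ j → last σ ≡ just (suc (suc j)) × suc (suc j) + suc (suc j) ≤ n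
  last-block mσ with k , mk , mσk ← find (∈-concatMap⁻ (block n) {kRange n} mσ) with j , refl , 2k≤n ← kRange⁻ {n} mk =
    j , last-in-block (suc (suc j)) mσk , 2k≤n
  unique-blocks : Unique (concatMap (block n) (kRange n))
  unique-blocks = Unique-concatMap (block n) (Unique.map⁺ (+-cancelʳ-≡ 2 _ _) (Unique.upTo⁺ _)) (λ {k} _ → Unique-block n k) same-k
    where
    same-k : ∀ {k k′ σ} → k ∈ kRange n → k′ ∈ kRange n → σ ∈ block n k → σ ∈ block n k′ → k ≡ k′
    same-k {k} {k′} mk mk′ mσ mσ′ with j , refl , _ ← kRange⁻ {n} mk with j′ , refl , _ ← kRange⁻ {n} mk′ =
      just-injective (trans (sym (last-in-block k mσ)) (last-in-block k′ mσ′))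
  last-frame : ∀ {σ} → σ ∈ map (frame n) (I132 n₀) → last σ ≡ just 1
  last-frame mσ with τ , _ , refl ← ∈-map⁻ (frame n) mσ = last-assemble n 0 n₀ [] τ []
  last-max : ∀ {σ} → σ ∈ map (appendMax n) (I132 (suc n₀)) → last σ ≡ just n
  last-max mσ with τ , _ , refl ← ∈-map⁻ (appendMax n) mσ = last-snoc τ n
  frame∩blocks : ∀ {σ} → ¬ (σ ∈ map (frame n) (I132 n₀) × σ ∈ concatMap (block n) (kRange n))
  frame∩blocks (m₁ , m₂) with j , l , _ ← last-block m₂ with () ← trans (sym (last-frame m₁)) l
  max∩rest : ∀ {σ} → ¬ (σ ∈ map (appendMax n) (I132 (suc n₀)) × σ ∈ (map (frame n) (I132 n₀) ++ concatMap (block n) (kRange n)))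
  max∩rest (m₁ , m₂) with ∈-++⁻ (map (frame n) (I132 n₀)) m₂
  ... | inj₁ m₃ with () ← trans (sym (last-max m₁)) (last-frame m₃)
  ... | inj₂ m₃ with j , l , 2k≤n ← last-block m₃ =
    <-irrefl (just-injective (trans (sym l) (last-max m₁))) (<-≤-trans (m<m+n (suc (suc j)) (s≤s z≤n)) 2k≤n)

statistic : List ℕ → Mon
statistic σ = (2 * comaj σ , asc σ)

-- τ , n: one more ascent, at position n - 1.
statistic-appendMax : ∀ n₀ {τ} → τ ∈ I132 (suc n₀) →
  statistic (appendMax (suc (suc n₀)) τ) ≡ (2 * comaj τ + 2 * suc n₀ , asc τ + 1)
statistic-appendMax n₀ {τ} m = cong₂ _,_ comaj-eq asc-eq
  where
  g : Involution (suc n₀) τ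
  g = proj₁ (I132⁻ (suc n₀) m)
  below : ∀ {v} → v ∈ τ → v < suc (suc n₀)
  below = s≤s ∘ proj₂ ∘ Involution-∈ g
  asc-eq : asc (τ ++ suc (suc n₀) ∷ []) ≡ asc τ + 1
  asc-eq = begin
    asc (τ ++ suc (suc n₀) ∷ [])   ≡⟨ asc≡ascents (τ ++ suc (suc n₀) ∷ []) ⟩
    ascents (τ ++ suc (suc n₀) ∷ []) ≡⟨ ascents-snoc-max τ _ below ⟩
    ascents τ + nonEmpty τ          ≡⟨ cong₂ _+_ (sym (asc≡ascents τ)) (nonEmpty-length τ (size g)) ⟩
    asc τ + 1                       ∎
    where open ≡-Reasoning
  comaj-eq : 2 * comaj (τ ++ suc (suc n₀) ∷ []) ≡ 2 * comaj τ + 2 * suc n₀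
  comaj-eq = begin
    2 * comaj (τ ++ suc (suc n₀) ∷ [])       ≡⟨ cong (2 *_) (comaj≡comajor (τ ++ suc (suc n₀) ∷ [])) ⟩
    2 * comajor (τ ++ suc (suc n₀) ∷ [])     ≡⟨ cong (2 *_) (comajor-snoc-max τ _ below) ⟩
    2 * (comajor τ + nonEmpty τ * length τ)  ≡⟨ cong₃ (sym (comaj≡comajor τ)) (nonEmpty-length τ (size g)) (size g) ⟩
    2 * (comaj τ + 1 * suc n₀)               ≡⟨ distribute (comaj τ) (suc n₀) ⟩
    2 * comaj τ + 2 * suc n₀                 ∎
    where
    open ≡-Reasoning
    cong₃ : ∀ {c c′ e e′ l l′} → c ≡ c′ → e ≡ e′ → l ≡ l′ → 2 * (c + e * l) ≡ 2 * (c′ + e′ * l′)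
    cong₃ refl refl refl = refl
    distribute : ∀ c l → 2 * (c + 1 * l) ≡ 2 * c + 2 * l
    distribute = solve-∀

-- n , τ + 1 , 1: one more ascent before each ascent of τ, none elsewhere.
statistic-frame : ∀ n₀ {τ} → τ ∈ I132 n₀ →
  statistic (frame (suc (suc n₀)) τ) ≡ (2 * comaj τ + 2 * asc τ , asc τ)
statistic-frame n₀ {τ} m = cong₂ _,_ comaj-eq asc-eq
  where
  g : Involution n₀ τ
  g = proj₁ (I132⁻ n₀ m)
  open AssemblyStatistics (suc (suc n₀)) 0 n₀ [] τ [] refl (λ ()) (λ ()) (Involution-∈ g)
  ascents-R′ : ascents R ≡ ascents τ
  ascents-R′ = trans ascents-R (+-identityʳ _)
  asc-eq : asc (frame (suc (suc n₀)) τ) ≡ asc τ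
  asc-eq = trans (asc≡ascents (frame (suc (suc n₀)) τ)) (trans ascents-assemble (trans ascents-R′ (sym (asc≡ascents τ))))
  comaj-eq : 2 * comaj (frame (suc (suc n₀)) τ) ≡ 2 * comaj τ + 2 * asc τ
  comaj-eq = begin
    2 * comaj (frame (suc (suc n₀)) τ)          ≡⟨ cong (2 *_) (trans (comaj≡comajor (frame (suc (suc n₀)) τ)) comajor-assemble) ⟩
    2 * (0 + 0 * 0 + (comajor R + ascents R + 0 * ascents R))
      ≡⟨ cong₂ (λ c a → 2 * (0 + 0 * 0 + (c + a + 0 * a))) (trans comajor-R (simplify (comajor τ) (length τ))) ascents-R′ ⟩
    2 * (0 + 0 * 0 + (comajor τ + ascents τ + 0 * ascents τ))
      ≡⟨ distribute (comajor τ) (ascents τ) ⟩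
    2 * comajor τ + 2 * ascents τ                ≡⟨ cong₂ (λ c a → 2 * c + 2 * a) (sym (comaj≡comajor τ)) (sym (asc≡ascents τ)) ⟩
    2 * comaj τ + 2 * asc τ                      ∎
    where
    open ≡-Reasoning
    simplify : ∀ c l → c + (0 + 0 * 0) + l * (0 + 0) ≡ c
    simplify = solve-∀
    distribute : ∀ c a → 2 * (0 + 0 * 0 + (c + a + 0 * a)) ≡ 2 * c + 2 * a
    distribute = solve-∀

assembly-exponents : ∀ {cσ aσ cτ aτ cφ aφ n₀} (C1 C2 A1 A2 j r : ℕ) →
  cσ ≡ C1 + 1 * j + ((cτ + (C2 + 1 * j) + r * (A2 + 1)) + (aτ + (A2 + 1)) + j * (aτ + (A2 + 1))) →
  aσ ≡ A1 + 1 + (aτ + (A2 + 1)) →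
  cφ ≡ C1 + 0 * j + (C2 + j * A2) → aφ ≡ A1 + 0 + A2 → A1 ≡ A2 → n₀ ≡ j + j + r →
  _≡_ {A = Mon} (2 * cσ , aσ) (2 * cτ + 2 * suc j * aτ + (2 * cφ + (r + 1) * aφ) + 2 * (n₀ + suc j) , aτ + aφ + 2)
assembly-exponents {cτ = cτ} {aτ = aτ} C1 C2 A1 A2 j r refl refl refl refl refl refl =
  cong₂ _,_ (comajor-identity C1 C2 A1 cτ aτ j r) (ascent-identity A1 aτ)
  where
  comajor-identity : ∀ C1 C2 A cτ aτ j r →
    2 * (C1 + 1 * j + ((cτ + (C2 + 1 * j) + r * (A + 1)) + (aτ + (A + 1)) + j * (aτ + (A + 1))))
    ≡ 2 * cτ + 2 * suc j * aτ + (2 * (C1 + 0 * j + (C2 + j * A)) + (r + 1) * (A + 0 + A)) + 2 * (j + j + r + suc j)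
  comajor-identity = solve-∀
  ascent-identity : ∀ A aτ → A + 1 + (aτ + (A + 1)) ≡ aτ + (A + 0 + A) + 2
  ascent-identity = solve-∀

module AssemblyOfHalves (n₀ j₀ : ℕ) {φ τ : List ℕ} (2k≤n : suc (suc j₀) + suc (suc j₀) ≤ suc (suc n₀))
  (mφ : φ ∈ FI132 (2 * suc j₀)) (mτ : τ ∈ I132 (suc (suc n₀) ∸ 2 * suc (suc j₀))) where

  n j r : ℕ
  n = suc (suc n₀)
  j = suc j₀
  r = n ∸ 2 * suc j
  H1 H2 σ : List ℕ
  H1 = take j φ
  H2 = drop j φ
  σ = assemble n j r H1 τ H2
  d : Assembly n j r H1 τ H2
  d = choice-assembly n j 2k≤n mφ mτ
  open Assembly d
  open AssemblyStatistics n j r H1 τ H2 total (λ m → proj₂ (Involution-∈ φ-inv (∈-++⁺ˡ m))) bottom-low (Involution-∈ τ-inv)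
  n₀≡ : n₀ ≡ j + j + r
  n₀≡ = suc-injective (suc-injective total)
  H1≠[] : nonEmpty H1 ≡ 1
  H1≠[] = nonEmpty-length H1 top-size
  H2≠[] : nonEmpty H2 ≡ 1
  H2≠[] = nonEmpty-length H2 bottom-size
  balanced-φ : ascents H1 ≡ ascents H2
  balanced-φ = HalfSplit.balanced (half-split j φ gφ fpφ no132φ)
    where
    gφ : Involution (j + j) φ
    gφ = proj₁ (FI132-size j mφ)
    fpφ : FixedPointFree φ
    fpφ = proj₁ (proj₂ (FI132-size j mφ))
    no132φ : ¬ Has132 φ
    no132φ = proj₂ (proj₂ (FI132-size j mφ))
  junction-halves : junction H1 H2 ≡ 0
  junction-halves = junction-descent H1 H2 (λ ma mz → <-≤-trans (s≤s (bottom-low mz)) (top-high ma))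
  ascents-φ : asc φ ≡ ascents H1 + 0 + ascents H2
  ascents-φ = trans (asc≡ascents φ) (trans (cong ascents (sym (take++drop≡id j φ)))
                (trans (ascents-++ H1 H2) (cong (λ t → ascents H1 + t + ascents H2) junction-halves)))
  comajor-φ : comaj φ ≡ comajor H1 + 0 * j + (comajor H2 + j * ascents H2)
  comajor-φ = trans (comaj≡comajor φ) (trans (cong comajor (sym (take++drop≡id j φ)))
                (trans (comajor-++ H1 H2)
                       (cong₂ (λ a l → comajor H1 + a * l + (comajor H2 + l * ascents H2)) junction-halves top-size)))
  ascents-R″ : ascents R ≡ ascents τ + (ascents H2 + 1)
  ascents-R″ = trans ascents-R (cong (λ t → ascents τ + (ascents H2 + t)) H2≠[])
  ascents-σ : ascents σ ≡ ascents H1 + 1 + (ascents τ + (ascents H2 + 1))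
  ascents-σ = trans ascents-assemble (cong₂ (λ a b → ascents H1 + a + b) H1≠[] ascents-R″)
  comajor-R″ : comajor R ≡ comajor τ + (comajor H2 + 1 * j) + r * (ascents H2 + 1)
  comajor-R″ = trans comajor-R (cong₃ H2≠[] bottom-size (size τ-inv))
    where
    cong₃ : ∀ {a a′ l l′ t t′} → a ≡ a′ → l ≡ l′ → t ≡ t′ →
            comajor τ + (comajor H2 + a * l) + t * (ascents H2 + a) ≡ comajor τ + (comajor H2 + a′ * l′) + t′ * (ascents H2 + a′)
    cong₃ refl refl refl = refl
  comajor-σ : comajor σ ≡
    comajor H1 + 1 * j + ((comajor τ + (comajor H2 + 1 * j) + r * (ascents H2 + 1))
      + (ascents τ + (ascents H2 + 1)) + j * (ascents τ + (ascents H2 + 1)))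
  comajor-σ = trans comajor-assemble (cong₄ H1≠[] top-size comajor-R″ ascents-R″)
    where
    cong₄ : ∀ {a a′ l l′ c c′ e e′} → a ≡ a′ → l ≡ l′ → c ≡ c′ → e ≡ e′ →
            comajor H1 + a * l + (c + e + l * e) ≡ comajor H1 + a′ * l′ + (c′ + e′ + l′ * e′)
    cong₄ refl refl refl refl = refl

  -- The assembly contributes
  -- q^{n+k-2} t^2 · (q^{(n-2k+1)/2})^{asc φ} q^{comaj φ} t^{asc φ} · (q^k)^{asc τ} q^{comaj τ} t^{asc τ}.
  statistic-halves : statistic (assembleHalves n (suc (suc j₀)) φ τ) ≡
    (2 * comaj τ + 2 * suc (suc j₀) * asc τ + (2 * comaj φ + (r + 1) * asc φ) + 2 * (n + suc (suc j₀) ∸ 2)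
    , asc τ + asc φ + 2)
  statistic-halves =
    trans (cong₂ _,_ (cong (2 *_) (comaj≡comajor σ)) (asc≡ascents σ))
      (trans (assembly-exponents {cτ = comajor τ} {aτ = ascents τ} (comajor H1) (comajor H2) (ascents H1) (ascents H2) j r
                                 comajor-σ ascents-σ comajor-φ ascents-φ balanced-φ n₀≡)
             (cong₂ (λ c a → (2 * c + 2 * suc j * a + (2 * comaj φ + (r + 1) * asc φ) + 2 * (n₀ + suc j) , a + asc φ + 2))
                    (sym (comaj≡comajor τ)) (sym (asc≡ascents τ))))

map-map-cong : ∀ {A B B′ C : Set} {f : A → B} {g : B → C} {f′ : A → B′} {g′ : B′ → C} (xs : List A) →
  (∀ {x} → x ∈ xs → g (f x) ≡ g′ (f′ x)) → map g (map f xs) ≡ map g′ (map f′ xs)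
map-map-cong []       eq = refl
map-map-cong (x ∷ xs) eq = cong₂ _∷_ (eq (here refl)) (map-map-cong xs (eq ∘ there))

generating-appendMax : ∀ n₀ →
  map statistic (map (appendMax (suc (suc n₀))) (I132 (suc n₀))) ≡ mulMon (2 * suc n₀ , 1) (M (suc n₀))
generating-appendMax n₀ = map-map-cong (I132 (suc n₀)) (statistic-appendMax n₀)

generating-frame : ∀ n₀ → map statistic (map (frame (suc (suc n₀))) (I132 n₀)) ≡ substT 2 (M n₀)
generating-frame n₀ = map-map-cong (I132 n₀) (statistic-frame n₀)

recTerm : ℕ → ℕ → Poly
recTerm n k = mulMon (2 * (n + k ∸ 2) , 2) (substT (n ∸ 2 * k + 1) (F (2 * (k ∸ 1))) ⊗ substT (2 * k) (M (n ∸ 2 * k)))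

module BlockGeneratingFunction (n₀ j₀ : ℕ) (2k≤n : suc (suc j₀) + suc (suc j₀) ≤ suc (suc n₀)) where
  n k r : ℕ
  n = suc (suc n₀)
  k = suc (suc j₀)
  r = n ∸ 2 * k

  fixed-φ : ∀ {φ} → φ ∈ FI132 (2 * suc j₀) → (T : List (List ℕ)) → (∀ {τ} → τ ∈ T → τ ∈ I132 r) →
    map statistic (map (assembleHalves n k φ) T) ≡
    mulMon (2 * (n + k ∸ 2) , 2) (mulMon (2 * comaj φ + (r + 1) * asc φ , asc φ) (substT (2 * k) (map statistic T)))
  fixed-φ mφ []      _   = refl
  fixed-φ mφ (τ ∷ T) mem =
    cong₂ _∷_ (AssemblyOfHalves.statistic-halves n₀ j₀ 2k≤n mφ (mem (here refl))) (fixed-φ mφ T (mem ∘ there))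

  over-φ : (Φ : List (List ℕ)) → (∀ {φ} → φ ∈ Φ → φ ∈ FI132 (2 * suc j₀)) →
    map statistic (concatMap (λ φ → map (assembleHalves n k φ) (I132 r)) Φ) ≡
    mulMon (2 * (n + k ∸ 2) , 2) (substT (r + 1) (map statistic Φ) ⊗ substT (2 * k) (M r))
  over-φ []      _   = refl
  over-φ (φ ∷ Φ) mem =
    trans (map-++ statistic (map (assembleHalves n k φ) (I132 r)) _)
      (trans (cong₂ _++_ (fixed-φ (mem (here refl)) (I132 r) (λ m → m)) (over-φ Φ (mem ∘ there)))
             (sym (map-++ _ (mulMon (2 * comaj φ + (r + 1) * asc φ , asc φ) (substT (2 * k) (M r)))
                            (substT (r + 1) (map statistic Φ) ⊗ substT (2 * k) (M r)))))

  block-term : map statistic (block n k) ≡ recTerm n k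
  block-term = over-φ (FI132 (2 * suc j₀)) (λ m → m)

generating-blocks : ∀ n₀ ks → (∀ {k} → k ∈ ks → k ∈ kRange (suc (suc n₀))) →
  map statistic (concatMap (block (suc (suc n₀))) ks) ≡ concatMap (recTerm (suc (suc n₀))) ks
generating-blocks n₀ []       _   = refl
generating-blocks n₀ (k ∷ ks) mem with j₀ , refl , 2k≤n ← kRange⁻ {suc (suc n₀)} (mem (here refl)) =
  trans (map-++ statistic (block (suc (suc n₀)) k) (concatMap (block (suc (suc n₀))) ks))
        (cong₂ _++_ (BlockGeneratingFunction.block-term n₀ j₀ 2k≤n) (generating-blocks n₀ ks (mem ∘ there)))

generating-enumeration : ∀ n₀ → map statistic (enumeration (suc (suc n₀))) ≡ recRHS (suc (suc n₀))
generating-enumeration n₀ = begin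
  map statistic (enumeration n)
    ≡⟨ map-++ statistic (map (appendMax n) (I132 (suc n₀))) _ ⟩
  map statistic (map (appendMax n) (I132 (suc n₀))) ++ map statistic (map (frame n) (I132 n₀) ++ concatMap (block n) (kRange n))
    ≡⟨ cong (map statistic (map (appendMax n) (I132 (suc n₀))) ++_) (map-++ statistic (map (frame n) (I132 n₀)) _) ⟩
  map statistic (map (appendMax n) (I132 (suc n₀))) ++ map statistic (map (frame n) (I132 n₀)) ++ map statistic (concatMap (block n) (kRange n))
    ≡⟨ cong₃ (generating-appendMax n₀) (generating-frame n₀) (generating-blocks n₀ (kRange n) (λ m → m)) ⟩
  recRHS n ∎
  where
  open ≡-Reasoning
  n : ℕ
  n = suc (suc n₀)
  cong₃ : ∀ {a a′ b b′ c c′ : Poly} → a ≡ a′ → b ≡ b′ → c ≡ c′ → a ++ b ++ c ≡ a′ ++ b′ ++ c′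
  cong₃ refl refl refl = refl

I132↭enumeration : ∀ n₀ → I132 (suc (suc n₀)) ↭ enumeration (suc (suc n₀))
I132↭enumeration n₀ = Unique-same-members-↭ (Unique-I132 (suc (suc n₀))) (Unique-enumeration n₀)
  (enumeration-complete n₀) (enumeration-sound n₀)

proposition4p8 : (M 0 ↭ one) × (M 1 ↭ one) × ((n : ℕ) → 2 ≤ n → M n ↭ recRHS n)
proposition4p8 = ↭-refl , ↭-refl , recurrence
  where
  recurrence : (n : ℕ) → 2 ≤ n → M n ↭ recRHS n
  recurrence (suc (suc n₀)) (s≤s (s≤s _)) =
    ↭-trans (Perm.map⁺ statistic (I132↭enumeration n₀)) (↭-reflexive (generating-enumeration n₀))
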